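{- For all nonnegative integers $L,M$, \[ \sum_{i,j\in\mathbb Z} (-1)^{i+j} q^{\binom{i+j}{2}} \begin{bmatrix}2L\\ L-i\end{bmatrix}_{q^2} \begin{bmatrix}2M\\ M-j\end{bmatrix}_{q^2} = (-1)^{M+L} q^{(L-M)^2}(q;q^2)_{L+M} . \]
   Context: $\binom{n}{2}:=n(n-1)/2$. The Gaussian binomial is $\begin{bmatrix}n+m\\ n\end{bmatrix}_q=\frac{(q)_{n+m}}{(q)_n(q)_m}$ if $n,m$ are nonnegative integers and $0$ otherwise, where $(q)_n=\prod_{j=1}^n(1-q^j)$. For $n\ge0$, $(a;q)_n=\prod_{j=0}^{n-1}(1-aq^j)$. -}

module Defs where

open import Data.Nat as ℕ using (ℕ; zero; suc; ⌊_/2⌋)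
open import Data.Integer as ℤ using (ℤ; +_; -[1+_]; ∣_∣)
open import Data.Rational as ℚ using (ℚ; 0ℚ; 1ℚ; _+_; _*_; _-_; _÷_; -_)
open import Data.Rational.Properties using (_≟_)
open import Relation.Nullary using (yes; no)

_^ℚ_ : ℚ → ℕ → ℚ
q ^ℚ zero = 1ℚ
q ^ℚ suc n = q * (q ^ℚ n)

qPoch : ℚ → ℚ → ℕ → ℚ
qPoch a q zero = 1ℚ
qPoch a q (suc n) = qPoch a q n * (1ℚ - a * (q ^ℚ n))

qFac : ℚ → ℕ → ℚ
qFac q zero = 1ℚ
qFac q (suc n) = qFac q n * (1ℚ - q ^ℚ suc n)

-- the quotient (q)_{n+m} / ((q)_n (q)_m) for natural n, m;
-- (junk value 0 if the denominator vanishes, which never happens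
--  under the hypotheses of the theorem)
gaussRatio : ℚ → ℕ → ℕ → ℚ
gaussRatio q n m with qFac q n * qFac q m ≟ 0ℚ
... | yes _ = 0ℚ
... | no d≢0 = qFac q (n ℕ.+ m) ÷ (qFac q n * qFac q m)
  where instance _ = ℚ.≢-nonZero d≢0

-- Gaussian binomial [N ; K]_q = [n+m ; n]_q with n = K, m = N - K,
-- for integers N, K; it is 0 unless n, m are both nonnegative.
gauss : ℚ → ℤ → ℤ → ℚ
gauss q N K with K | N ℤ.- K
... | + n | + m = gaussRatio q n m
... | + _ | -[1+ _ ] = 0ℚ
... | -[1+ _ ] | _ = 0ℚ

-- binom(k,2) = k(k-1)/2 for an integer k (always a natural number)
binom2 : ℤ → ℕ
binom2 k = ⌊ ∣ k ℤ.* (k ℤ.- ℤ.1ℤ) ∣ /2⌋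

negOnePow : ℤ → ℚ
negOnePow k = (- 1ℚ) ^ℚ ∣ k ∣

sumFrom : ℤ → ℕ → (ℤ → ℚ) → ℚ
sumFrom a zero f = 0ℚ
sumFrom a (suc n) f = sumFrom a n f + f (a ℤ.+ + n)

sumSym : ℕ → (ℤ → ℚ) → ℚ
sumSym L f = sumFrom (ℤ.- (+ L)) (suc (2 ℕ.* L)) f

-- Write θ k = (-1)^k q^(k choose 2) and read the double sum S(L,M) as a pairing
-- Σ w(i,j) [2L; L-i] [2M; M-j] of a weight w against central q²-binomials, with w(i,j) = θ(i+j);
-- let T(L,M) be the same pairing with the twisted weight θ(i+j) q^(j-i).  Pascal's rule writes
-- [2L+2; L+1-i] through [2L; L-i] and [2L; L-i±1], i.e. it shifts the weight by ±1 in i, and the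
-- quasi-periodicity θ(k+1) = -q^k θ(k), θ(-k) = q^k θ(k) together with the reflection i, j ↦ -i, -j
-- turns every shifted weight back into θ(i+j) or its twist (possibly with L and M exchanged).  The
-- result is a pair of recurrences for S(L+1,M) and T(L+1,M) in terms of S(L,M), T(L,M), T(M,L),
-- which the right-hand side C(L,M) satisfies in the form S = C and q^(2L) T = C, because
-- C(L+1,M) = (q^(4L+2) - q^(2L-2M+1)) C(L,M); induction on L + M finishes.  This uses q^(-1); at
-- q = 0 the binomials are 1 on the range, θ(k) = δ(k) - δ(k-1) telescopes, and the sum is [L = M].

module Submission where

open import Defs
open import Data.Nat as ℕ using (ℕ; zero; suc; ⌊_/2⌋)
import Data.Nat.Properties as ℕP
open import Data.Integer as ℤ using (ℤ; +_; -[1+_]; ∣_∣)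
import Data.Integer.Properties as ℤP
open import Data.Rational as ℚ using (ℚ; 0ℚ; 1ℚ; _*_; _+_; -_; _-_; 1/_; _≤_)
import Data.Rational.Properties as ℚP
open import Data.Empty using (⊥-elim)
open import Data.List.Base using ([]; _∷_)
open import Data.Product using (_×_; _,_)
open import Data.Sum using (inj₁; inj₂)
open import Level using (0ℓ)
open import Relation.Nullary using (¬_; yes; no)
open import Relation.Nullary.Decidable.Core using (dec⇒maybe)
open import Relation.Binary.PropositionalEquality
open import Tactic.RingSolver using (solve-∀)
import Tactic.RingSolver.Core.AlmostCommutativeRing as ACR
import Data.Integer.Tactic.RingSolver as ℤ-Solver
import Data.Nat.Tactic.RingSolver as ℕ-Solver

open ≡-Reasoning

ℚ-ring : ACR.AlmostCommutativeRing 0ℓ 0ℓ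
ℚ-ring = ACR.fromCommutativeRing ℚP.+-*-commutativeRing (λ x → dec⇒maybe (0ℚ ℚP.≟ x))

*-cancelʳ-≢0 : ∀ {x y c} → c ≢ 0ℚ → x * c ≡ y * c → x ≡ y
*-cancelʳ-≢0 {x} {y} {c} c≢0 xc≡yc = begin
  x            ≡⟨ sym (divide x) ⟩
  x * c * 1/ c ≡⟨ cong (_* 1/ c) xc≡yc ⟩
  y * c * 1/ c ≡⟨ divide y ⟩
  y            ∎
  where
  instance _ = ℚ.≢-nonZero c≢0
  divide : ∀ z → z * c * 1/ c ≡ z
  divide z = trans (ℚP.*-assoc z c (1/ c)) (trans (cong (z *_) (ℚP.*-inverseʳ c)) (ℚP.*-identityʳ z))

*≡0⇒≡0 : ∀ {x y} → x ≢ 0ℚ → x * y ≡ 0ℚ → y ≡ 0ℚ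
*≡0⇒≡0 {x} {y} x≢0 xy≡0 =
  *-cancelʳ-≢0 x≢0 (trans (ℚP.*-comm y x) (trans xy≡0 (sym (ℚP.*-zeroˡ x))))

*-≢0 : ∀ {x y} → x ≢ 0ℚ → y ≢ 0ℚ → x * y ≢ 0ℚ
*-≢0 x≢0 y≢0 xy≡0 = y≢0 (*≡0⇒≡0 x≢0 xy≡0)

1-x≡0⇒x≡1 : ∀ {x} → 1ℚ - x ≡ 0ℚ → x ≡ 1ℚ
1-x≡0⇒x≡1 {x} e = trans (double-negation x) (cong (λ z → 1ℚ - z) e)
  where
  double-negation : ∀ x → x ≡ 1ℚ - (1ℚ - x)
  double-negation = solve-∀ ℚ-ring

x*[y*z]≡y*[x*z] : ∀ x y z → x * (y * z) ≡ y * (x * z)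
x*[y*z]≡y*[x*z] = solve-∀ ℚ-ring

x*y*z≡x*[z*y] : ∀ x y z → x * y * z ≡ x * (z * y)
x*y*z≡x*[z*y] = solve-∀ ℚ-ring

x+y*0≡x : ∀ x y → x + y * 0ℚ ≡ x
x+y*0≡x = solve-∀ ℚ-ring

^-+ : ∀ (x : ℚ) m n → x ^ℚ (m ℕ.+ n) ≡ x ^ℚ m * x ^ℚ n
^-+ x zero    n = sym (ℚP.*-identityˡ _)
^-+ x (suc m) n = trans (cong (x *_) (^-+ x m n)) (sym (ℚP.*-assoc x _ _))

^2-^ : ∀ (x : ℚ) n → (x ^ℚ 2) ^ℚ n ≡ x ^ℚ (n ℕ.+ n)
^2-^ x zero    = refl
^2-^ x (suc n) = begin
  x ^ℚ 2 * (x ^ℚ 2) ^ℚ n  ≡⟨ cong (x ^ℚ 2 *_) (^2-^ x n) ⟩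
  x ^ℚ 2 * x ^ℚ (n ℕ.+ n) ≡⟨ sym (^-+ x 2 (n ℕ.+ n)) ⟩
  x ^ℚ (2 ℕ.+ (n ℕ.+ n))  ≡⟨ cong (λ k → x ^ℚ suc k) (sym (ℕP.+-suc n n)) ⟩
  x ^ℚ (suc n ℕ.+ suc n)  ∎

negOnePow-suc : ∀ k → negOnePow (k ℤ.+ + 1) ≡ - negOnePow k
negOnePow-suc (+ n) rewrite ℕP.+-comm n 1 = flip (negOnePow (+ n))
  where
  flip : ∀ x → - 1ℚ * x ≡ - x
  flip = solve-∀ ℚ-ring
negOnePow-suc -[1+ zero ]  = refl
negOnePow-suc -[1+ suc n ] = unflip ((- 1ℚ) ^ℚ suc n)
  where
  unflip : ∀ x → x ≡ - (- 1ℚ * x)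
  unflip = solve-∀ ℚ-ring

negOnePow-neg : ∀ k → negOnePow (ℤ.- k) ≡ negOnePow k
negOnePow-neg k = cong ((- 1ℚ) ^ℚ_) (ℤP.∣-i∣≡∣i∣ k)

+∣x∣^2≡x*x : ∀ x → + (∣ x ∣ ℕ.^ 2) ≡ x ℤ.* x
+∣x∣^2≡x*x (+ n)     = trans (cong (λ m → + (n ℕ.* m)) (ℕP.*-identityʳ n)) (ℤP.pos-* n n)
+∣x∣^2≡x*x -[1+ n ]  = cong (λ m → + (suc n ℕ.* m)) (ℕP.*-identityʳ (suc n))

triangle : ℕ → ℕ
triangle zero    = zero
triangle (suc n) = suc n ℕ.+ triangle n

n*[1+n]≡triangle+triangle : ∀ n → n ℕ.* suc n ≡ triangle n ℕ.+ triangle n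
n*[1+n]≡triangle+triangle zero    = refl
n*[1+n]≡triangle+triangle (suc n) = begin
  suc n ℕ.* suc (suc n)                      ≡⟨ expand n ⟩
  n ℕ.* suc n ℕ.+ 2 ℕ.* suc n                ≡⟨ cong (ℕ._+ 2 ℕ.* suc n) (n*[1+n]≡triangle+triangle n) ⟩
  triangle n ℕ.+ triangle n ℕ.+ 2 ℕ.* suc n  ≡⟨ regroup n (triangle n) ⟩
  triangle (suc n) ℕ.+ triangle (suc n)      ∎
  where
  expand : ∀ n → suc n ℕ.* suc (suc n) ≡ n ℕ.* suc n ℕ.+ 2 ℕ.* suc n
  expand = ℕ-Solver.solve-∀
  regroup : ∀ n t → t ℕ.+ t ℕ.+ 2 ℕ.* suc n ≡ (suc n ℕ.+ t) ℕ.+ (suc n ℕ.+ t)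
  regroup = ℕ-Solver.solve-∀

⌊n+n/2⌋≡n : ∀ n → ⌊ n ℕ.+ n /2⌋ ≡ n
⌊n+n/2⌋≡n zero    = refl
⌊n+n/2⌋≡n (suc n) rewrite ℕP.+-suc n n = cong suc (⌊n+n/2⌋≡n n)

binom2≡⌊∣k∣*∣k-1∣/2⌋ : ∀ k → binom2 k ≡ ⌊ ∣ k ∣ ℕ.* ∣ k ℤ.- + 1 ∣ /2⌋
binom2≡⌊∣k∣*∣k-1∣/2⌋ k = cong ⌊_/2⌋ (ℤP.abs-* k (k ℤ.- + 1))

binom2-+suc : ∀ n → binom2 (+ suc n) ≡ triangle n
binom2-+suc n = begin
  binom2 (+ suc n)               ≡⟨ binom2≡⌊∣k∣*∣k-1∣/2⌋ (+ suc n) ⟩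
  ⌊ suc n ℕ.* n /2⌋              ≡⟨ cong ⌊_/2⌋ (trans (ℕP.*-comm (suc n) n) (n*[1+n]≡triangle+triangle n)) ⟩
  ⌊ triangle n ℕ.+ triangle n /2⌋ ≡⟨ ⌊n+n/2⌋≡n (triangle n) ⟩
  triangle n                     ∎

binom2--suc : ∀ n → binom2 -[1+ n ] ≡ triangle (suc n)
binom2--suc n = begin
  binom2 -[1+ n ]                          ≡⟨ binom2≡⌊∣k∣*∣k-1∣/2⌋ -[1+ n ] ⟩
  ⌊ suc n ℕ.* suc (suc (n ℕ.+ 0)) /2⌋      ≡⟨ cong (λ m → ⌊ suc n ℕ.* suc (suc m) /2⌋) (ℕP.+-identityʳ n) ⟩
  ⌊ suc n ℕ.* suc (suc n) /2⌋              ≡⟨ cong ⌊_/2⌋ (n*[1+n]≡triangle+triangle (suc n)) ⟩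
  ⌊ triangle (suc n) ℕ.+ triangle (suc n) /2⌋ ≡⟨ ⌊n+n/2⌋≡n (triangle (suc n)) ⟩
  triangle (suc n)                         ∎

binom2-suc : ∀ k → + binom2 (k ℤ.+ + 1) ≡ + binom2 k ℤ.+ k
binom2-suc (+ zero)    = refl
binom2-suc (+ suc n)   = begin
  + binom2 (+ (suc n ℕ.+ 1))          ≡⟨ cong (λ m → + binom2 (+ m)) (ℕP.+-comm (suc n) 1) ⟩
  + binom2 (+ suc (suc n))            ≡⟨ cong +_ (binom2-+suc (suc n)) ⟩
  + (suc n ℕ.+ triangle n)            ≡⟨ trans (ℤP.pos-+ (suc n) (triangle n)) (ℤP.+-comm (+ suc n) (+ triangle n)) ⟩
  + triangle n ℤ.+ + suc n            ≡⟨ cong (λ m → + m ℤ.+ + suc n) (sym (binom2-+suc n)) ⟩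
  + binom2 (+ suc n) ℤ.+ + suc n      ∎
binom2-suc -[1+ zero ]  = refl
binom2-suc -[1+ suc n ] = begin
  + binom2 -[1+ n ]                            ≡⟨ cong +_ (binom2--suc n) ⟩
  + t                                          ≡⟨ add-and-subtract (+ t) (+ suc (suc n)) ⟩
  + t ℤ.+ + suc (suc n) ℤ.+ -[1+ suc n ]       ≡⟨ cong (ℤ._+ -[1+ suc n ]) (sym (ℤP.pos-+ t (suc (suc n)))) ⟩
  + (t ℕ.+ suc (suc n)) ℤ.+ -[1+ suc n ]       ≡⟨ cong (λ m → + m ℤ.+ -[1+ suc n ]) (ℕP.+-comm t (suc (suc n))) ⟩
  + triangle (suc (suc n)) ℤ.+ -[1+ suc n ]    ≡⟨ cong (λ m → + m ℤ.+ -[1+ suc n ]) (sym (binom2--suc (suc n))) ⟩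
  + binom2 -[1+ suc n ] ℤ.+ -[1+ suc n ]       ∎
  where
  t = triangle (suc n)
  add-and-subtract : ∀ x y → x ≡ x ℤ.+ y ℤ.+ ℤ.- y
  add-and-subtract = ℤ-Solver.solve-∀

binom2-neg : ∀ k → binom2 (ℤ.- k) ≡ binom2 (k ℤ.+ + 1)
binom2-neg (+ zero)    = refl
binom2-neg (+ suc n)   = begin
  binom2 -[1+ n ]            ≡⟨ binom2--suc n ⟩
  triangle (suc n)           ≡⟨ sym (binom2-+suc (suc n)) ⟩
  binom2 (+ suc (suc n))     ≡⟨ cong (λ m → binom2 (+ m)) (ℕP.+-comm 1 (suc n)) ⟩
  binom2 (+ (suc n ℕ.+ 1))   ∎
binom2-neg -[1+ zero ]  = refl
binom2-neg -[1+ suc n ] = trans (binom2-+suc (suc n)) (sym (binom2--suc n))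

-- Sums over integer ranges

sumFrom-cong : ∀ {a n} {f g : ℤ → ℚ} → (∀ i → f i ≡ g i) → sumFrom a n f ≡ sumFrom a n g
sumFrom-cong {n = zero}  f≗g = refl
sumFrom-cong {a} {suc n} f≗g = cong₂ _+_ (sumFrom-cong {a} {n} f≗g) (f≗g _)

sumFrom-+ : ∀ {a n} (f g : ℤ → ℚ) → sumFrom a n (λ i → f i + g i) ≡ sumFrom a n f + sumFrom a n g
sumFrom-+ {n = zero}      f g = refl
sumFrom-+ {a} {n = suc n} f g = trans (cong (_+ (f i + g i)) (sumFrom-+ {a} {n} f g)) (interchange (sumFrom a n f) (sumFrom a n g) (f i) (g i))
  where
  i = a ℤ.+ + n
  interchange : ∀ x y z w → (x + y) + (z + w) ≡ (x + z) + (y + w)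
  interchange = solve-∀ ℚ-ring

sumFrom-*ˡ : ∀ {a n} c (f : ℤ → ℚ) → sumFrom a n (λ i → c * f i) ≡ c * sumFrom a n f
sumFrom-*ˡ {n = zero}  c f = sym (ℚP.*-zeroʳ c)
sumFrom-*ˡ {a} {suc n} c f = trans (cong (_+ c * f (a ℤ.+ + n)) (sumFrom-*ˡ {a} {n} c f)) (sym (ℚP.*-distribˡ-+ c _ _))

sumFrom-neg : ∀ {a n} (f : ℤ → ℚ) → sumFrom a n (λ i → - f i) ≡ - sumFrom a n f
sumFrom-neg {n = zero}  f = refl
sumFrom-neg {a} {suc n} f =
  trans (cong (_+ - f (a ℤ.+ + n)) (sumFrom-neg {a} {n} f)) (sym (ℚP.neg-distrib-+ (sumFrom a n f) (f (a ℤ.+ + n))))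

sumFrom-zero : ∀ {a n} {f : ℤ → ℚ} → (∀ i → f i ≡ 0ℚ) → sumFrom a n f ≡ 0ℚ
sumFrom-zero {n = zero}  f≗0 = refl
sumFrom-zero {a} {suc n} f≗0 = cong₂ _+_ (sumFrom-zero {a} {n} f≗0) (f≗0 _)

sumFrom-swap : ∀ {a n b m} (F : ℤ → ℤ → ℚ) →
  sumFrom a n (λ i → sumFrom b m (λ j → F i j)) ≡ sumFrom b m (λ j → sumFrom a n (λ i → F i j))
sumFrom-swap {n = zero} {b} {m} F = sym (sumFrom-zero {b} {m} (λ _ → refl))
sumFrom-swap {a} {suc n} {b} {m} F = trans (cong (_+ sumFrom b m (F (a ℤ.+ + n))) (sumFrom-swap {a} {n} {b} {m} F))
  (sym (sumFrom-+ {b} {m} (λ j → sumFrom a n (λ i → F i j)) (λ j → F (a ℤ.+ + n) j)))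

sumFrom-cons : ∀ a n (f : ℤ → ℚ) → sumFrom a (suc n) f ≡ f a + sumFrom (a ℤ.+ + 1) n f
sumFrom-cons a zero    f = trans (ℚP.+-identityˡ _) (trans (cong f (ℤP.+-identityʳ a)) (sym (ℚP.+-identityʳ _)))
sumFrom-cons a (suc n) f = begin
  sumFrom a (suc n) f + f (a ℤ.+ + suc n)
    ≡⟨ cong₂ _+_ (sumFrom-cons a n f) (cong f (reassociate a (+ n))) ⟩
  f a + sumFrom (a ℤ.+ + 1) n f + f (a ℤ.+ + 1 ℤ.+ + n)
    ≡⟨ ℚP.+-assoc (f a) _ _ ⟩
  f a + sumFrom (a ℤ.+ + 1) (suc n) f ∎
  where
  reassociate : ∀ a b → a ℤ.+ (+ 1 ℤ.+ b) ≡ a ℤ.+ + 1 ℤ.+ b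
  reassociate = ℤ-Solver.solve-∀

sumFrom-shift : ∀ a n c (f : ℤ → ℚ) → sumFrom a n (λ i → f (i ℤ.+ c)) ≡ sumFrom (a ℤ.+ c) n f
sumFrom-shift a zero    c f = refl
sumFrom-shift a (suc n) c f = cong₂ _+_ (sumFrom-shift a n c f) (cong f (commute a (+ n) c))
  where
  commute : ∀ a b c → a ℤ.+ b ℤ.+ c ≡ a ℤ.+ c ℤ.+ b
  commute = ℤ-Solver.solve-∀

sumSym-cong : ∀ L {f g : ℤ → ℚ} → (∀ i → f i ≡ g i) → sumSym L f ≡ sumSym L g
sumSym-cong L = sumFrom-cong {ℤ.- (+ L)} {suc (2 ℕ.* L)}

sumSym-+ : ∀ L (f g : ℤ → ℚ) → sumSym L (λ i → f i + g i) ≡ sumSym L f + sumSym L g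
sumSym-+ L = sumFrom-+ {ℤ.- (+ L)} {suc (2 ℕ.* L)}

sumSym-*ˡ : ∀ L c (f : ℤ → ℚ) → sumSym L (λ i → c * f i) ≡ c * sumSym L f
sumSym-*ˡ L = sumFrom-*ˡ {ℤ.- (+ L)} {suc (2 ℕ.* L)}

sumSym-neg : ∀ L (f : ℤ → ℚ) → sumSym L (λ i → - f i) ≡ - sumSym L f
sumSym-neg L = sumFrom-neg {ℤ.- (+ L)} {suc (2 ℕ.* L)}

sumSym-zero : ∀ L {f : ℤ → ℚ} → (∀ i → f i ≡ 0ℚ) → sumSym L f ≡ 0ℚ
sumSym-zero L = sumFrom-zero {ℤ.- (+ L)} {suc (2 ℕ.* L)}

sumSym-swap : ∀ L M (F : ℤ → ℤ → ℚ) →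
  sumSym L (λ i → sumSym M (λ j → F i j)) ≡ sumSym M (λ j → sumSym L (λ i → F i j))
sumSym-swap L M = sumFrom-swap {ℤ.- (+ L)} {suc (2 ℕ.* L)} {ℤ.- (+ M)} {suc (2 ℕ.* M)}

2*[1+n]≡2+2*n : ∀ n → 2 ℕ.* suc n ≡ suc (suc (2 ℕ.* n))
2*[1+n]≡2+2*n = ℕ-Solver.solve-∀

-[1+n]+1≡-n : ∀ n → -[1+ n ] ℤ.+ + 1 ≡ ℤ.- (+ n)
-[1+n]+1≡-n zero    = refl
-[1+n]+1≡-n (suc n) = refl

-n+[d+2n]≡d+n : ∀ n d → ℤ.- (+ n) ℤ.+ + (d ℕ.+ 2 ℕ.* n) ≡ + (d ℕ.+ n)
-n+[d+2n]≡d+n n d = begin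
  ℤ.- (+ n) ℤ.+ + (d ℕ.+ 2 ℕ.* n)
    ≡⟨ cong (λ z → ℤ.- (+ n) ℤ.+ z) (trans (ℤP.pos-+ d (2 ℕ.* n)) (cong (λ z → + d ℤ.+ z) (ℤP.pos-* 2 n))) ⟩
  ℤ.- (+ n) ℤ.+ (+ d ℤ.+ + 2 ℤ.* + n) ≡⟨ cancel (+ d) (+ n) ⟩
  + d ℤ.+ + n                         ≡⟨ sym (ℤP.pos-+ d n) ⟩
  + (d ℕ.+ n)                         ∎
  where
  cancel : ∀ d x → ℤ.- x ℤ.+ (d ℤ.+ + 2 ℤ.* x) ≡ d ℤ.+ x
  cancel = ℤ-Solver.solve-∀

sumSym-suc : ∀ L (f : ℤ → ℚ) → sumSym (suc L) f ≡ f -[1+ L ] + sumSym L f + f (+ suc L)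
sumSym-suc L f = begin
  sumFrom -[1+ L ] (suc (2 ℕ.* suc L)) f
    ≡⟨ cong (λ n → sumFrom -[1+ L ] (suc n) f) (2*[1+n]≡2+2*n L) ⟩
  sumFrom -[1+ L ] (suc (suc (suc (2 ℕ.* L)))) f
    ≡⟨ sumFrom-cons -[1+ L ] (suc (suc (2 ℕ.* L))) f ⟩
  f -[1+ L ] + sumFrom (-[1+ L ] ℤ.+ + 1) (suc (suc (2 ℕ.* L))) f
    ≡⟨ cong (λ a → f -[1+ L ] + sumFrom a (suc (suc (2 ℕ.* L))) f) (-[1+n]+1≡-n L) ⟩
  f -[1+ L ] + (sumSym L f + f (ℤ.- (+ L) ℤ.+ + suc (2 ℕ.* L)))
    ≡⟨ sym (ℚP.+-assoc (f -[1+ L ]) (sumSym L f) _) ⟩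
  f -[1+ L ] + sumSym L f + f (ℤ.- (+ L) ℤ.+ + suc (2 ℕ.* L))
    ≡⟨ cong (λ i → f -[1+ L ] + sumSym L f + f i) (-n+[d+2n]≡d+n L 1) ⟩
  f -[1+ L ] + sumSym L f + f (+ suc L) ∎

sumSym-reflect : ∀ L (f : ℤ → ℚ) → sumSym L (λ i → f (ℤ.- i)) ≡ sumSym L f
sumSym-reflect zero    f = refl
sumSym-reflect (suc L) f = begin
  sumSym (suc L) (λ i → f (ℤ.- i))
    ≡⟨ sumSym-suc L _ ⟩
  f (+ suc L) + sumSym L (λ i → f (ℤ.- i)) + f -[1+ L ]
    ≡⟨ cong (λ x → f (+ suc L) + x + f -[1+ L ]) (sumSym-reflect L f) ⟩
  f (+ suc L) + sumSym L f + f -[1+ L ]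
    ≡⟨ swap-ends (f (+ suc L)) (sumSym L f) (f -[1+ L ]) ⟩
  f -[1+ L ] + sumSym L f + f (+ suc L)
    ≡⟨ sym (sumSym-suc L f) ⟩
  sumSym (suc L) f ∎
  where
  swap-ends : ∀ x y z → x + y + z ≡ z + y + x
  swap-ends = solve-∀ ℚ-ring

sumSym-extend : ∀ L (f : ℤ → ℚ) → f -[1+ L ] ≡ 0ℚ → f (+ suc L) ≡ 0ℚ → sumSym (suc L) f ≡ sumSym L f
sumSym-extend L f f₋≡0 f₊≡0 rewrite sumSym-suc L f | f₋≡0 | f₊≡0 =
  trans (ℚP.+-identityʳ _) (ℚP.+-identityˡ _)

sumSym-shift-suc : ∀ L (g : ℤ → ℚ) → g (+ suc L) ≡ 0ℚ → g (+ suc (suc L)) ≡ 0ℚ →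
  sumSym (suc L) (λ i → g (i ℤ.+ + 1)) ≡ sumSym L g
sumSym-shift-suc L g g₁≡0 g₂≡0 = begin
  sumFrom -[1+ L ] (suc (2 ℕ.* suc L)) (λ i → g (i ℤ.+ + 1))
    ≡⟨ sumFrom-shift -[1+ L ] (suc (2 ℕ.* suc L)) (+ 1) g ⟩
  sumFrom (-[1+ L ] ℤ.+ + 1) (suc (2 ℕ.* suc L)) g
    ≡⟨ cong₂ (λ a n → sumFrom a (suc n) g) (-[1+n]+1≡-n L) (2*[1+n]≡2+2*n L) ⟩
  sumSym L g + g (ℤ.- (+ L) ℤ.+ + suc (2 ℕ.* L)) + g (ℤ.- (+ L) ℤ.+ + suc (suc (2 ℕ.* L)))
    ≡⟨ cong₂ (λ x y → sumSym L g + g x + g y) (-n+[d+2n]≡d+n L 1) (-n+[d+2n]≡d+n L 2) ⟩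
  sumSym L g + g (+ suc L) + g (+ suc (suc L))
    ≡⟨ cong₂ (λ x y → sumSym L g + x + y) g₁≡0 g₂≡0 ⟩
  sumSym L g + 0ℚ + 0ℚ
    ≡⟨ trans (ℚP.+-identityʳ _) (ℚP.+-identityʳ _) ⟩
  sumSym L g ∎

sumSym-shift-pred : ∀ L (g : ℤ → ℚ) → g -[1+ L ] ≡ 0ℚ → g -[1+ suc L ] ≡ 0ℚ →
  sumSym (suc L) (λ i → g (i ℤ.- + 1)) ≡ sumSym L g
sumSym-shift-pred L g g₁≡0 g₂≡0 = begin
  sumSym (suc L) (λ i → g (i ℤ.- + 1))
    ≡⟨ sym (sumSym-reflect (suc L) (λ i → g (i ℤ.- + 1))) ⟩
  sumSym (suc L) (λ i → g (ℤ.- i ℤ.- + 1))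
    ≡⟨ sumSym-cong (suc L) (λ i → cong g (negate-shift i)) ⟩
  sumSym (suc L) (λ i → g (ℤ.- (i ℤ.+ + 1)))
    ≡⟨ sumSym-shift-suc L (λ i → g (ℤ.- i)) g₁≡0 g₂≡0 ⟩
  sumSym L (λ i → g (ℤ.- i))
    ≡⟨ sumSym-reflect L g ⟩
  sumSym L g ∎
  where
  negate-shift : ∀ i → ℤ.- i ℤ.- + 1 ≡ ℤ.- (i ℤ.+ + 1)
  negate-shift = ℤ-Solver.solve-∀

-- Gaussian binomial coefficients

+[k+m]-+k≡+m : ∀ k m → + (k ℕ.+ m) ℤ.- + k ≡ + m
+[k+m]-+k≡+m k m = trans (cong (ℤ._- + k) (ℤP.pos-+ k m)) (x+y-x≡y (+ k) (+ m))
  where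
  x+y-x≡y : ∀ x y → x ℤ.+ y ℤ.- x ≡ y
  x+y-x≡y = ℤ-Solver.solve-∀

+n-+[n+suc-b]≡-[1+b] : ∀ n b → + n ℤ.- + (n ℕ.+ suc b) ≡ -[1+ b ]
+n-+[n+suc-b]≡-[1+b] n b = trans (cong (λ z → + n ℤ.- z) (ℤP.pos-+ n (suc b))) (x-[x+y]≡-y (+ n) (+ suc b))
  where
  x-[x+y]≡-y : ∀ x y → x ℤ.- (x ℤ.+ y) ≡ ℤ.- y
  x-[x+y]≡-y = ℤ-Solver.solve-∀

data Placement (a n : ℕ) : Set where
  within : ∀ m → a ℕ.+ m ≡ n → Placement a n
  beyond : ∀ b → n ℕ.+ suc b ≡ a → Placement a n

placement : ∀ a n → Placement a n
placement zero    n       = within n refl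
placement (suc a) zero    = beyond a refl
placement (suc a) (suc n) with placement a n
... | within m a+m≡n = within m (cong suc a+m≡n)
... | beyond b n+b≡a = beyond b (cong suc n+b≡a)

module GaussianBinomial (p : ℚ) where

  -- qBinom n m = [n + m ; n]_p
  qBinom : ℕ → ℕ → ℚ
  qBinom zero    m       = 1ℚ
  qBinom (suc n) zero    = 1ℚ
  qBinom (suc n) (suc m) = qBinom n (suc m) + p ^ℚ suc n * qBinom (suc n) m

  qBinom-qFac : ∀ n m → qBinom n m * (qFac p n * qFac p m) ≡ qFac p (n ℕ.+ m)
  qBinom-qFac zero    m       = trans (ℚP.*-identityˡ _) (ℚP.*-identityˡ _)
  qBinom-qFac (suc n) zero    =
    trans (ℚP.*-identityˡ _) (trans (ℚP.*-identityʳ _) (cong (qFac p) (sym (ℕP.+-identityʳ (suc n)))))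
  qBinom-qFac (suc n) (suc m) = begin
    (A + P * B) * ((F n * (1ℚ - P)) * (F m * (1ℚ - Q)))
      ≡⟨ split A B P Q (F n) (F m) ⟩
    (1ℚ - P) * (A * (F n * (F m * (1ℚ - Q)))) + (P * (1ℚ - Q)) * (B * ((F n * (1ℚ - P)) * F m))
      ≡⟨ cong₂ (λ x y → (1ℚ - P) * x + (P * (1ℚ - Q)) * y)
               (trans (qBinom-qFac n (suc m)) (cong F (ℕP.+-suc n m))) (qBinom-qFac (suc n) m) ⟩
    (1ℚ - P) * F (suc n ℕ.+ m) + (P * (1ℚ - Q)) * F (suc n ℕ.+ m)
      ≡⟨ collect P Q (F (suc n ℕ.+ m)) ⟩
    F (suc n ℕ.+ m) * (1ℚ - P * Q)
      ≡⟨ cong (λ z → F (suc n ℕ.+ m) * (1ℚ - z)) P*Q ⟩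
    F (suc (suc (n ℕ.+ m)))
      ≡⟨ cong (λ k → F (suc k)) (sym (ℕP.+-suc n m)) ⟩
    F (suc n ℕ.+ suc m) ∎
    where
    F = qFac p
    A = qBinom n (suc m)
    B = qBinom (suc n) m
    P = p ^ℚ suc n
    Q = p ^ℚ suc m
    split : ∀ A B P Q Fn Fm → (A + P * B) * ((Fn * (1ℚ - P)) * (Fm * (1ℚ - Q))) ≡
            (1ℚ - P) * (A * (Fn * (Fm * (1ℚ - Q)))) + (P * (1ℚ - Q)) * (B * ((Fn * (1ℚ - P)) * Fm))
    split = solve-∀ ℚ-ring
    collect : ∀ P Q X → (1ℚ - P) * X + (P * (1ℚ - Q)) * X ≡ X * (1ℚ - P * Q)
    collect = solve-∀ ℚ-ring
    P*Q : P * Q ≡ p ^ℚ suc (suc (n ℕ.+ m))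
    P*Q = trans (sym (^-+ p (suc n) (suc m))) (cong (λ k → p ^ℚ suc k) (ℕP.+-suc n m))

  gauss-complement-negative : ∀ N K n a → K ≡ + n → N ℤ.- K ≡ -[1+ a ] → gauss p N K ≡ 0ℚ
  gauss-complement-negative N K n a e₁ e₂ with K | N ℤ.- K
  gauss-complement-negative N K n a refl refl | + n | -[1+ a ] = refl

  gauss-above : ∀ n b {k} → n ℕ.+ suc b ≡ k → gauss p (+ n) (+ k) ≡ 0ℚ
  gauss-above n b refl =
    gauss-complement-negative (+ n) (+ (n ℕ.+ suc b)) (n ℕ.+ suc b) b refl (+n-+[n+suc-b]≡-[1+b] n b)

  qBinom-n-0 : ∀ n → qBinom n 0 ≡ 1ℚ
  qBinom-n-0 zero    = refl
  qBinom-n-0 (suc n) = refl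

  module NotRootOfUnity (p^suc≢1 : ∀ j → p ^ℚ suc j ≢ 1ℚ) where

    qFac≢0 : ∀ n → qFac p n ≢ 0ℚ
    qFac≢0 zero    ()
    qFac≢0 (suc n) = *-≢0 (qFac≢0 n) (λ e → p^suc≢1 n (1-x≡0⇒x≡1 e))

    qBinom-comm : ∀ n m → qBinom n m ≡ qBinom m n
    qBinom-comm n m = *-cancelʳ-≢0 (*-≢0 (qFac≢0 n) (qFac≢0 m)) (begin
      qBinom n m * (qFac p n * qFac p m) ≡⟨ qBinom-qFac n m ⟩
      qFac p (n ℕ.+ m)                   ≡⟨ cong (qFac p) (ℕP.+-comm n m) ⟩
      qFac p (m ℕ.+ n)                   ≡⟨ sym (qBinom-qFac m n) ⟩
      qBinom m n * (qFac p m * qFac p n) ≡⟨ cong (qBinom m n *_) (ℚP.*-comm (qFac p m) (qFac p n)) ⟩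
      qBinom m n * (qFac p n * qFac p m) ∎)

    gaussRatio≡qBinom : ∀ n m → gaussRatio p n m ≡ qBinom n m
    gaussRatio≡qBinom n m with qFac p n * qFac p m ℚP.≟ 0ℚ
    ... | yes d≡0 = ⊥-elim (*-≢0 (qFac≢0 n) (qFac≢0 m) d≡0)
    ... | no  d≢0 = begin
      qFac p (n ℕ.+ m) * 1/ D       ≡⟨ cong (_* 1/ D) (sym (qBinom-qFac n m)) ⟩
      qBinom n m * D * 1/ D         ≡⟨ ℚP.*-assoc (qBinom n m) D (1/ D) ⟩
      qBinom n m * (D * 1/ D)       ≡⟨ cong (qBinom n m *_) (ℚP.*-inverseʳ D) ⟩
      qBinom n m * 1ℚ               ≡⟨ ℚP.*-identityʳ (qBinom n m) ⟩
      qBinom n m                    ∎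
      where
      D = qFac p n * qFac p m
      instance _ = ℚ.≢-nonZero d≢0

    gauss-complement-positive : ∀ N K n m → K ≡ + n → N ℤ.- K ≡ + m → gauss p N K ≡ qBinom n m
    gauss-complement-positive N K n m e₁ e₂ with K | N ℤ.- K
    gauss-complement-positive N K n m refl refl | + n | + m = gaussRatio≡qBinom n m

    gauss-inside : ∀ {n} k m → k ℕ.+ m ≡ n → gauss p (+ n) (+ k) ≡ qBinom k m
    gauss-inside k m refl = gauss-complement-positive (+ (k ℕ.+ m)) (+ k) k m refl (+[k+m]-+k≡+m k m)

    gauss-reflect : ∀ n k → gauss p (+ n) k ≡ gauss p (+ n) (+ n ℤ.- k)
    gauss-reflect n -[1+ a ] = sym (gauss-above n a refl)
    gauss-reflect n (+ a) with placement a n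
    gauss-reflect .(a ℕ.+ m) (+ a) | within m refl = begin
      gauss p (+ (a ℕ.+ m)) (+ a)                     ≡⟨ gauss-inside a m refl ⟩
      qBinom a m                                      ≡⟨ qBinom-comm a m ⟩
      qBinom m a                                      ≡⟨ sym (gauss-inside m a (ℕP.+-comm m a)) ⟩
      gauss p (+ (a ℕ.+ m)) (+ m)                     ≡⟨ cong (gauss p (+ (a ℕ.+ m))) (sym (+[k+m]-+k≡+m a m)) ⟩
      gauss p (+ (a ℕ.+ m)) (+ (a ℕ.+ m) ℤ.- + a)     ∎
    gauss-reflect n (+ .(n ℕ.+ suc b)) | beyond b refl =
      trans (gauss-above n b refl) (sym (cong (gauss p (+ n)) (+n-+[n+suc-b]≡-[1+b] n b)))

    central : ℕ → ℤ → ℚ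
    central L i = gauss p (+ (2 ℕ.* L)) (+ L ℤ.- i)

    central-reflect : ∀ L i → central L (ℤ.- i) ≡ central L i
    central-reflect L i = trans (gauss-reflect (2 ℕ.* L) (+ L ℤ.- ℤ.- i))
      (cong (gauss p (+ (2 ℕ.* L))) (trans (cong (λ z → z ℤ.- (+ L ℤ.- ℤ.- i)) (ℤP.pos-* 2 L)) (reflect-index (+ L) i)))
      where
      reflect-index : ∀ x i → + 2 ℤ.* x ℤ.- (x ℤ.- ℤ.- i) ≡ x ℤ.- i
      reflect-index = ℤ-Solver.solve-∀

    central-above : ∀ L d → central L (+ (suc d ℕ.+ L)) ≡ 0ℚ
    central-above L d = cong (gauss p (+ (2 ℕ.* L))) index
      where
      index : + L ℤ.- + (suc d ℕ.+ L) ≡ -[1+ d ]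
      index = trans (cong (λ z → + L ℤ.- + z) (ℕP.+-comm (suc d) L)) (+n-+[n+suc-b]≡-[1+b] L d)

    central-below : ∀ L d → central L -[1+ d ℕ.+ L ] ≡ 0ℚ
    central-below L d = gauss-above (2 ℕ.* L) d (regroup L d)
      where
      regroup : ∀ L d → 2 ℕ.* L ℕ.+ suc d ≡ L ℕ.+ suc (d ℕ.+ L)
      regroup = ℕ-Solver.solve-∀

    -- Only the values of p^ at natural exponents matter: gauss vanishes where p^ is evaluated elsewhere.
    module Pascal (p^ : ℤ → ℚ) (p^-natural : ∀ n → p^ (+ n) ≡ p ^ℚ n) where

      pascal₁ : ∀ n k → gauss p (+ suc n) k ≡ gauss p (+ n) (k ℤ.- + 1) + p^ k * gauss p (+ n) k
      pascal₁ n -[1+ a ] = sym (x+y*0≡x 0ℚ (p^ -[1+ a ]))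
      pascal₁ n (+ zero) = begin
        gauss p (+ suc n) (+ 0)              ≡⟨ gauss-inside 0 (suc n) refl ⟩
        0ℚ + 1ℚ * 1ℚ                         ≡⟨ cong₂ (λ x y → 0ℚ + x * y) (sym (p^-natural 0)) (sym (gauss-inside 0 n refl)) ⟩
        0ℚ + p^ (+ 0) * gauss p (+ n) (+ 0)  ∎
      pascal₁ n (+ suc a) with placement a n
      pascal₁ .(a ℕ.+ 0) (+ suc a) | within zero refl = begin
        gauss p (+ suc (a ℕ.+ 0)) (+ suc a)
          ≡⟨ gauss-inside (suc a) 0 refl ⟩
        1ℚ
          ≡⟨ sym (x+y*0≡x 1ℚ (p^ (+ suc a))) ⟩
        1ℚ + p^ (+ suc a) * 0ℚ
          ≡⟨ cong₂ (λ x y → x + p^ (+ suc a) * y)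
                   (sym (trans (gauss-inside a 0 refl) (qBinom-n-0 a))) (sym (gauss-above (a ℕ.+ 0) 0 a+0+1≡1+a)) ⟩
        gauss p (+ (a ℕ.+ 0)) (+ a) + p^ (+ suc a) * gauss p (+ (a ℕ.+ 0)) (+ suc a) ∎
        where
        a+0+1≡1+a : a ℕ.+ 0 ℕ.+ 1 ≡ suc a
        a+0+1≡1+a = trans (ℕP.+-comm (a ℕ.+ 0) 1) (cong suc (ℕP.+-identityʳ a))
      pascal₁ .(a ℕ.+ suc m) (+ suc a) | within (suc m) refl = begin
        gauss p (+ suc (a ℕ.+ suc m)) (+ suc a)
          ≡⟨ gauss-inside (suc a) (suc m) refl ⟩
        qBinom a (suc m) + p ^ℚ suc a * qBinom (suc a) m
          ≡⟨ cong₂ (λ x y → x + y * qBinom (suc a) m) (sym (gauss-inside a (suc m) refl)) (sym (p^-natural (suc a))) ⟩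
        gauss p (+ (a ℕ.+ suc m)) (+ a) + p^ (+ suc a) * qBinom (suc a) m
          ≡⟨ cong (λ y → gauss p (+ (a ℕ.+ suc m)) (+ a) + p^ (+ suc a) * y) (sym (gauss-inside (suc a) m (sym (ℕP.+-suc a m)))) ⟩
        gauss p (+ (a ℕ.+ suc m)) (+ a) + p^ (+ suc a) * gauss p (+ (a ℕ.+ suc m)) (+ suc a) ∎
      pascal₁ n (+ suc .(n ℕ.+ suc b)) | beyond b refl = begin
        gauss p (+ suc n) (+ suc (n ℕ.+ suc b))
          ≡⟨ gauss-above (suc n) b refl ⟩
        0ℚ
          ≡⟨ sym (x+y*0≡x 0ℚ (p^ (+ suc (n ℕ.+ suc b)))) ⟩
        0ℚ + p^ (+ suc (n ℕ.+ suc b)) * 0ℚ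
          ≡⟨ cong₂ (λ x y → x + p^ (+ suc (n ℕ.+ suc b)) * y)
                   (sym (gauss-above n b refl)) (sym (gauss-above n (suc b) (ℕP.+-suc n (suc b)))) ⟩
        gauss p (+ n) (+ (n ℕ.+ suc b)) + p^ (+ suc (n ℕ.+ suc b)) * gauss p (+ n) (+ suc (n ℕ.+ suc b)) ∎

      pascal₂ : ∀ n k → gauss p (+ suc n) k ≡ p^ (+ suc n ℤ.- k) * gauss p (+ n) (k ℤ.- + 1) + gauss p (+ n) k
      pascal₂ n k = begin
        gauss p (+ suc n) k
          ≡⟨ gauss-reflect (suc n) k ⟩
        gauss p (+ suc n) k′
          ≡⟨ pascal₁ n k′ ⟩
        gauss p (+ n) (k′ ℤ.- + 1) + p^ k′ * gauss p (+ n) k′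
          ≡⟨ cong₂ (λ x y → gauss p (+ n) x + p^ k′ * gauss p (+ n) y) (index₁ (+ n) k) (index₂ (+ n) k) ⟩
        gauss p (+ n) (+ n ℤ.- k) + p^ k′ * gauss p (+ n) (+ n ℤ.- (k ℤ.- + 1))
          ≡⟨ cong₂ (λ x y → x + p^ k′ * y) (sym (gauss-reflect n k)) (sym (gauss-reflect n (k ℤ.- + 1))) ⟩
        gauss p (+ n) k + p^ k′ * gauss p (+ n) (k ℤ.- + 1)
          ≡⟨ ℚP.+-comm (gauss p (+ n) k) _ ⟩
        p^ k′ * gauss p (+ n) (k ℤ.- + 1) + gauss p (+ n) k ∎
        where
        k′ = + suc n ℤ.- k
        index₁ : ∀ x k → + 1 ℤ.+ x ℤ.- k ℤ.- + 1 ≡ x ℤ.- k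
        index₁ = ℤ-Solver.solve-∀
        index₂ : ∀ x k → + 1 ℤ.+ x ℤ.- k ≡ x ℤ.- (k ℤ.- + 1)
        index₂ = ℤ-Solver.solve-∀

      central-pascal : ∀ L i → central (suc L) i ≡
        p^ (+ L ℤ.+ + 1 ℤ.+ i) * central L (i ℤ.+ + 1)
        + (p^ (+ L ℤ.+ + 1 ℤ.+ i) * p^ (+ L ℤ.- i) + p^ (+ L ℤ.+ i)) * central L i
        + central L (i ℤ.- + 1)
      central-pascal L i = begin
        gauss p (+ (2 ℕ.* suc L)) k
          ≡⟨ cong (λ n → gauss p (+ n) k) (2*[1+n]≡2+2*n L) ⟩
        gauss p (+ suc (suc N)) k
          ≡⟨ pascal₂ (suc N) k ⟩
        A * gauss p (+ suc N) (k ℤ.- + 1) + gauss p (+ suc N) k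
          ≡⟨ cong₂ (λ x y → A * x + y) (pascal₁ N (k ℤ.- + 1)) (pascal₂ N k) ⟩
        A * (G (k ℤ.- + 1 ℤ.- + 1) + C * G (k ℤ.- + 1)) + (D * G (k ℤ.- + 1) + G k)
          ≡⟨ collect A C D (G (k ℤ.- + 1 ℤ.- + 1)) (G (k ℤ.- + 1)) (G k) ⟩
        A * G (k ℤ.- + 1 ℤ.- + 1) + (A * C + D) * G (k ℤ.- + 1) + G k
          ≡⟨ cong₂ (λ x y → A * G x + (A * C + D) * G y + G k) (shift₂ (+ L) i) (shift₁ (+ L) i) ⟩
        A * central L (i ℤ.+ + 1) + (A * C + D) * central L i + G k
          ≡⟨ cong (λ x → A * central L (i ℤ.+ + 1) + (A * C + D) * central L i + G x) (shift₀ (+ L) i) ⟩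
        A * central L (i ℤ.+ + 1) + (A * C + D) * central L i + central L (i ℤ.- + 1)
          ≡⟨ cong (λ x → p^ x * central L (i ℤ.+ + 1) + (p^ x * C + D) * central L i + central L (i ℤ.- + 1))
                  (exponent₂ (+ L) (+ N) i (ℤP.pos-* 2 L)) ⟩
        A′ * central L (i ℤ.+ + 1) + (A′ * C + D) * central L i + central L (i ℤ.- + 1)
          ≡⟨ cong₂ (λ x y → A′ * central L (i ℤ.+ + 1) + (A′ * p^ x + p^ y) * central L i + central L (i ℤ.- + 1))
                   (shift₁ (+ L) i) (exponent₁ (+ L) (+ N) i (ℤP.pos-* 2 L)) ⟩
        A′ * central L (i ℤ.+ + 1) + (A′ * p^ (+ L ℤ.- i) + p^ (+ L ℤ.+ i)) * central L i + central L (i ℤ.- + 1) ∎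
        where
        N = 2 ℕ.* L
        k = + suc L ℤ.- i
        G = gauss p (+ N)
        A = p^ (+ suc (suc N) ℤ.- k)
        A′ = p^ (+ L ℤ.+ + 1 ℤ.+ i)
        C = p^ (k ℤ.- + 1)
        D = p^ (+ suc N ℤ.- k)
        collect : ∀ A C D x y z → A * (x + C * y) + (D * y + z) ≡ A * x + (A * C + D) * y + z
        collect = solve-∀ ℚ-ring
        shift₂ : ∀ x i → + 1 ℤ.+ x ℤ.- i ℤ.- + 1 ℤ.- + 1 ≡ x ℤ.- (i ℤ.+ + 1)
        shift₂ = ℤ-Solver.solve-∀
        shift₁ : ∀ x i → + 1 ℤ.+ x ℤ.- i ℤ.- + 1 ≡ x ℤ.- i
        shift₁ = ℤ-Solver.solve-∀
        shift₀ : ∀ x i → + 1 ℤ.+ x ℤ.- i ≡ x ℤ.- (i ℤ.- + 1)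
        shift₀ = ℤ-Solver.solve-∀
        exponent₂ : ∀ x n i → n ≡ + 2 ℤ.* x → + 1 ℤ.+ (+ 1 ℤ.+ n) ℤ.- (+ 1 ℤ.+ x ℤ.- i) ≡ x ℤ.+ + 1 ℤ.+ i
        exponent₂ x _ i refl = ℤ-Solver.solve (x ∷ i ∷ [])
        exponent₁ : ∀ x n i → n ≡ + 2 ℤ.* x → + 1 ℤ.+ n ℤ.- (+ 1 ℤ.+ x ℤ.- i) ≡ x ℤ.+ i
        exponent₁ x _ i refl = ℤ-Solver.solve (x ∷ i ∷ [])

-- Integer powers of q and θ k = (-1)^k q^(k choose 2)

module IntegerPower (q : ℚ) (q≢0 : q ≢ 0ℚ) where

  instance
    q-nonZero : ℚ.NonZero q
    q-nonZero = ℚ.≢-nonZero q≢0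

  q^ : ℤ → ℚ
  q^ (+ n)    = q ^ℚ n
  q^ -[1+ n ] = (1/ q) ^ℚ suc n

  q^-suc : ∀ k → q^ (k ℤ.+ + 1) ≡ q * q^ k
  q^-suc (+ n) rewrite ℕP.+-comm n 1 = refl
  q^-suc -[1+ zero ]  = begin
    1ℚ              ≡⟨ sym (ℚP.*-inverseʳ q) ⟩
    q * 1/ q        ≡⟨ cong (q *_) (sym (ℚP.*-identityʳ (1/ q))) ⟩
    q * (1/ q * 1ℚ) ∎
  q^-suc -[1+ suc n ] = begin
    (1/ q) ^ℚ suc n               ≡⟨ sym (ℚP.*-identityˡ _) ⟩
    1ℚ * (1/ q) ^ℚ suc n          ≡⟨ cong (_* (1/ q) ^ℚ suc n) (sym (ℚP.*-inverseʳ q)) ⟩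
    q * 1/ q * (1/ q) ^ℚ suc n    ≡⟨ ℚP.*-assoc q (1/ q) _ ⟩
    q * (1/ q * (1/ q) ^ℚ suc n)  ∎

  q^-pred : ∀ k → q^ (k ℤ.- + 1) ≡ 1/ q * q^ k
  q^-pred k = begin
    q^ (k ℤ.- + 1)                 ≡⟨ sym (ℚP.*-identityˡ _) ⟩
    1ℚ * q^ (k ℤ.- + 1)            ≡⟨ cong (_* q^ (k ℤ.- + 1)) (sym (ℚP.*-inverseˡ q)) ⟩
    1/ q * q * q^ (k ℤ.- + 1)      ≡⟨ ℚP.*-assoc (1/ q) q _ ⟩
    1/ q * (q * q^ (k ℤ.- + 1))    ≡⟨ cong (1/ q *_) (sym (q^-suc (k ℤ.- + 1))) ⟩
    1/ q * q^ (k ℤ.- + 1 ℤ.+ + 1)  ≡⟨ cong (λ x → 1/ q * q^ x) (k-1+1≡k k) ⟩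
    1/ q * q^ k                    ∎
    where
    k-1+1≡k : ∀ k → k ℤ.- + 1 ℤ.+ + 1 ≡ k
    k-1+1≡k = ℤ-Solver.solve-∀

  q^-+ : ∀ a b → q^ (a ℤ.+ b) ≡ q^ a * q^ b
  q^-+ a (+ zero)      = trans (cong q^ (ℤP.+-identityʳ a)) (sym (ℚP.*-identityʳ _))
  q^-+ a (+ suc n)     = begin
    q^ (a ℤ.+ + suc n)          ≡⟨ cong q^ (regroup a (+ n)) ⟩
    q^ (a ℤ.+ + n ℤ.+ + 1)      ≡⟨ q^-suc (a ℤ.+ + n) ⟩
    q * q^ (a ℤ.+ + n)          ≡⟨ cong (q *_) (q^-+ a (+ n)) ⟩
    q * (q^ a * q^ (+ n))       ≡⟨ x*[y*z]≡y*[x*z] q (q^ a) (q^ (+ n)) ⟩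
    q^ a * (q * q^ (+ n))       ∎
    where
    regroup : ∀ a b → a ℤ.+ (+ 1 ℤ.+ b) ≡ a ℤ.+ b ℤ.+ + 1
    regroup = ℤ-Solver.solve-∀
  q^-+ a -[1+ zero ]   = trans (q^-pred a) (x*y≡y*[x*1] (1/ q) (q^ a))
    where
    x*y≡y*[x*1] : ∀ x y → x * y ≡ y * (x * 1ℚ)
    x*y≡y*[x*1] = solve-∀ ℚ-ring
  q^-+ a -[1+ suc n ]  = begin
    q^ (a ℤ.+ -[1+ suc n ])      ≡⟨ cong q^ (regroup a n) ⟩
    q^ (a ℤ.+ -[1+ n ] ℤ.- + 1)  ≡⟨ q^-pred (a ℤ.+ -[1+ n ]) ⟩
    1/ q * q^ (a ℤ.+ -[1+ n ])   ≡⟨ cong (1/ q *_) (q^-+ a -[1+ n ]) ⟩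
    1/ q * (q^ a * q^ -[1+ n ])  ≡⟨ x*[y*z]≡y*[x*z] (1/ q) (q^ a) (q^ -[1+ n ]) ⟩
    q^ a * (1/ q * q^ -[1+ n ])  ∎
    where
    regroup : ∀ a n → a ℤ.+ -[1+ suc n ] ≡ a ℤ.+ -[1+ n ] ℤ.- + 1
    regroup a n = trans (cong (λ m → a ℤ.+ -[1+ suc m ]) (sym (ℕP.+-identityʳ n)))
                        (sym (ℤP.+-assoc a -[1+ n ] (ℤ.- + 1)))

  q^-merge : ∀ a b {c} → a ℤ.+ b ≡ c → q^ a * q^ b ≡ q^ c
  q^-merge a b a+b≡c = trans (sym (q^-+ a b)) (cong q^ a+b≡c)

  q^-inverse : ∀ k → q^ (ℤ.- k) * q^ k ≡ 1ℚ
  q^-inverse k = q^-merge (ℤ.- k) k (ℤP.+-inverseˡ k)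

  θ : ℤ → ℚ
  θ k = negOnePow k * q ^ℚ binom2 k

  θ-suc : ∀ k → θ (k ℤ.+ + 1) ≡ - (q^ k * θ k)
  θ-suc k = begin
    negOnePow (k ℤ.+ + 1) * q^ (+ binom2 (k ℤ.+ + 1))
      ≡⟨ cong₂ _*_ (negOnePow-suc k) (cong q^ (binom2-suc k)) ⟩
    (- negOnePow k) * q^ (+ binom2 k ℤ.+ k)
      ≡⟨ cong ((- negOnePow k) *_) (q^-+ (+ binom2 k) k) ⟩
    (- negOnePow k) * (q^ (+ binom2 k) * q^ k)
      ≡⟨ rearrange (negOnePow k) (q^ (+ binom2 k)) (q^ k) ⟩
    - (q^ k * θ k) ∎
    where
    rearrange : ∀ x y z → (- x) * (y * z) ≡ - (z * (x * y))
    rearrange = solve-∀ ℚ-ring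

  θ-neg : ∀ k → θ (ℤ.- k) ≡ q^ k * θ k
  θ-neg k = begin
    negOnePow (ℤ.- k) * q^ (+ binom2 (ℤ.- k))
      ≡⟨ cong₂ (λ x y → x * q^ (+ y)) (negOnePow-neg k) (binom2-neg k) ⟩
    negOnePow k * q^ (+ binom2 (k ℤ.+ + 1))
      ≡⟨ cong (λ x → negOnePow k * q^ x) (binom2-suc k) ⟩
    negOnePow k * q^ (+ binom2 k ℤ.+ k)
      ≡⟨ cong (negOnePow k *_) (q^-+ (+ binom2 k) k) ⟩
    negOnePow k * (q^ (+ binom2 k) * q^ k)
      ≡⟨ rearrange (negOnePow k) (q^ (+ binom2 k)) (q^ k) ⟩
    q^ k * θ k ∎
    where
    rearrange : ∀ x y z → x * (y * z) ≡ z * (x * y)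
    rearrange = solve-∀ ℚ-ring

  θ-1-k : ∀ k → θ (+ 1 ℤ.- k) ≡ - θ k
  θ-1-k k = begin
    θ (+ 1 ℤ.- k)                    ≡⟨ cong θ (1-k≡-[k-1] k) ⟩
    θ (ℤ.- (k ℤ.- + 1))              ≡⟨ θ-neg (k ℤ.- + 1) ⟩
    q^ (k ℤ.- + 1) * θ (k ℤ.- + 1)   ≡⟨ double-negation _ ⟩
    - (- (q^ (k ℤ.- + 1) * θ (k ℤ.- + 1))) ≡⟨ cong -_ (sym (θ-suc (k ℤ.- + 1))) ⟩
    - θ (k ℤ.- + 1 ℤ.+ + 1)          ≡⟨ cong (λ x → - θ x) (k-1+1≡k k) ⟩
    - θ k                            ∎
    where
    1-k≡-[k-1] : ∀ k → + 1 ℤ.- k ≡ ℤ.- (k ℤ.- + 1)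
    1-k≡-[k-1] = ℤ-Solver.solve-∀
    k-1+1≡k : ∀ k → k ℤ.- + 1 ℤ.+ + 1 ≡ k
    k-1+1≡k = ℤ-Solver.solve-∀
    double-negation : ∀ x → x ≡ - (- x)
    double-negation = solve-∀ ℚ-ring

  θ-pred : ∀ k → θ (k ℤ.- + 1) ≡ - (q^ (+ 1 ℤ.- k) * θ k)
  θ-pred k = begin
    θ (k ℤ.- + 1)                          ≡⟨ cong θ (sym (-[1-k]≡k-1 k)) ⟩
    θ (ℤ.- (+ 1 ℤ.- k))                    ≡⟨ θ-neg (+ 1 ℤ.- k) ⟩
    q^ (+ 1 ℤ.- k) * θ (+ 1 ℤ.- k)         ≡⟨ cong (q^ (+ 1 ℤ.- k) *_) (θ-1-k k) ⟩
    q^ (+ 1 ℤ.- k) * (- θ k)               ≡⟨ sym (ℚP.neg-distribʳ-* (q^ (+ 1 ℤ.- k)) (θ k)) ⟩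
    - (q^ (+ 1 ℤ.- k) * θ k)               ∎
    where
    -[1-k]≡k-1 : ∀ k → ℤ.- (+ 1 ℤ.- k) ≡ k ℤ.- + 1
    -[1-k]≡k-1 = ℤ-Solver.solve-∀

-- The case q ≠ 0

module Pairing (q : ℚ) (q≢0 : q ≢ 0ℚ) (q²^suc≢1 : ∀ j → (q ^ℚ 2) ^ℚ suc j ≢ 1ℚ) where

  open IntegerPower q q≢0
  open GaussianBinomial (q ^ℚ 2)
  open NotRootOfUnity q²^suc≢1

  q²^ : ℤ → ℚ
  q²^ k = q^ (k ℤ.+ k)

  open Pascal q²^ (λ n → sym (^2-^ q n))

  pairing : ℕ → ℕ → (ℤ → ℤ → ℚ) → ℚ
  pairing L M w = sumSym L (λ i → sumSym M (λ j → w i j * central L i * central M j))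

  pairing-cong : ∀ L M {w w′ : ℤ → ℤ → ℚ} → (∀ i j → w i j ≡ w′ i j) → pairing L M w ≡ pairing L M w′
  pairing-cong L M w≗w′ =
    sumSym-cong L (λ i → sumSym-cong M (λ j → cong (λ x → x * central L i * central M j) (w≗w′ i j)))

  pairing-+ : ∀ L M (w w′ : ℤ → ℤ → ℚ) → pairing L M (λ i j → w i j + w′ i j) ≡ pairing L M w + pairing L M w′
  pairing-+ L M w w′ = begin
    pairing L M (λ i j → w i j + w′ i j)
      ≡⟨ sumSym-cong L (λ i → sumSym-cong M (λ j → distrib (w i j) (w′ i j) (central L i) (central M j))) ⟩
    sumSym L (λ i → sumSym M (λ j → term w i j + term w′ i j))
      ≡⟨ sumSym-cong L (λ i → sumSym-+ M (term w i) (term w′ i)) ⟩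
    sumSym L (λ i → sumSym M (term w i) + sumSym M (term w′ i))
      ≡⟨ sumSym-+ L _ _ ⟩
    pairing L M w + pairing L M w′ ∎
    where
    term : (ℤ → ℤ → ℚ) → ℤ → ℤ → ℚ
    term v i j = v i j * central L i * central M j
    distrib : ∀ a b x y → (a + b) * x * y ≡ a * x * y + b * x * y
    distrib = solve-∀ ℚ-ring

  pairing-*ˡ : ∀ L M c (w : ℤ → ℤ → ℚ) → pairing L M (λ i j → c * w i j) ≡ c * pairing L M w
  pairing-*ˡ L M c w = begin
    pairing L M (λ i j → c * w i j)
      ≡⟨ sumSym-cong L (λ i → sumSym-cong M (λ j → assoc c (w i j) (central L i) (central M j))) ⟩
    sumSym L (λ i → sumSym M (λ j → c * (w i j * central L i * central M j)))
      ≡⟨ sumSym-cong L (λ i → sumSym-*ˡ M c _) ⟩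
    sumSym L (λ i → c * sumSym M (λ j → w i j * central L i * central M j))
      ≡⟨ sumSym-*ˡ L c _ ⟩
    c * pairing L M w ∎
    where
    assoc : ∀ c a x y → c * a * x * y ≡ c * (a * x * y)
    assoc = solve-∀ ℚ-ring

  pairing-neg : ∀ L M (w : ℤ → ℤ → ℚ) → pairing L M (λ i j → - w i j) ≡ - pairing L M w
  pairing-neg L M w = begin
    pairing L M (λ i j → - w i j)
      ≡⟨ sumSym-cong L (λ i → sumSym-cong M (λ j → pull-out (w i j) (central L i) (central M j))) ⟩
    sumSym L (λ i → sumSym M (λ j → - (w i j * central L i * central M j)))
      ≡⟨ sumSym-cong L (λ i → sumSym-neg M _) ⟩
    sumSym L (λ i → - sumSym M (λ j → w i j * central L i * central M j))
      ≡⟨ sumSym-neg L _ ⟩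
    - pairing L M w ∎
    where
    pull-out : ∀ a x y → (- a) * x * y ≡ - (a * x * y)
    pull-out = solve-∀ ℚ-ring

  pairing-reflect : ∀ L M (w : ℤ → ℤ → ℚ) → pairing L M w ≡ pairing L M (λ i j → w (ℤ.- i) (ℤ.- j))
  pairing-reflect L M w = begin
    pairing L M w
      ≡⟨ sym (sumSym-reflect L _) ⟩
    sumSym L (λ i → sumSym M (λ j → w (ℤ.- i) j * central L (ℤ.- i) * central M j))
      ≡⟨ sumSym-cong L (λ i → sym (sumSym-reflect M _)) ⟩
    sumSym L (λ i → sumSym M (λ j → w (ℤ.- i) (ℤ.- j) * central L (ℤ.- i) * central M (ℤ.- j)))
      ≡⟨ sumSym-cong L (λ i → sumSym-cong M (λ j →
           cong₂ (λ x y → w (ℤ.- i) (ℤ.- j) * x * y) (central-reflect L i) (central-reflect M j))) ⟩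
    pairing L M (λ i j → w (ℤ.- i) (ℤ.- j)) ∎

  pairing-swap : ∀ L M (w : ℤ → ℤ → ℚ) → pairing L M w ≡ pairing M L (λ i j → w j i)
  pairing-swap L M w = trans (sumSym-swap L M _)
    (sumSym-cong M (λ j → sumSym-cong L (λ i → swap (w i j) (central L i) (central M j))))
    where
    swap : ∀ a x y → a * x * y ≡ a * y * x
    swap = solve-∀ ℚ-ring

  row-vanishes : ∀ L M (w : ℤ → ℤ → ℚ) i → central L i ≡ 0ℚ →
    sumSym M (λ j → w i j * central L i * central M j) ≡ 0ℚ
  row-vanishes L M w i cᵢ≡0 = sumSym-zero M (λ j →
    trans (cong (λ x → w i j * x * central M j) cᵢ≡0) (annihilate (w i j) (central M j)))
    where
    annihilate : ∀ a b → a * 0ℚ * b ≡ 0ℚ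
    annihilate = solve-∀ ℚ-ring

  pairing-suc : ∀ L M (w : ℤ → ℤ → ℚ) → pairing (suc L) M w ≡
      pairing L M (λ i j → q²^ (+ L ℤ.+ i) * w (i ℤ.- + 1) j)
    + pairing L M (λ i j → (q^ (+ 4 ℤ.* + L ℤ.+ + 2) + q²^ (+ L ℤ.+ i)) * w i j)
    + pairing L M (λ i j → w (i ℤ.+ + 1) j)
  pairing-suc L M w = begin
    pairing (suc L) M w
      ≡⟨ sumSym-cong (suc L) (λ i → sumSym-cong M (λ j →
           cong (λ x → w i j * x * central M j) (central-pascal L i))) ⟩
    sumSym (suc L) (λ i → sumSym M (λ j →
      w i j * (A i * central L (i ℤ.+ + 1) + B i * central L i + central L (i ℤ.- + 1)) * central M j))
      ≡⟨ sumSym-cong (suc L) split ⟩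
    sumSym (suc L) (λ i → row W₁ (i ℤ.+ + 1) + row W₂ i + row W₃ (i ℤ.- + 1))
      ≡⟨ trans (sumSym-+ (suc L) _ _) (cong (_+ sumSym (suc L) (λ i → row W₃ (i ℤ.- + 1))) (sumSym-+ (suc L) _ _)) ⟩
    sumSym (suc L) (λ i → row W₁ (i ℤ.+ + 1)) + sumSym (suc L) (row W₂) + sumSym (suc L) (λ i → row W₃ (i ℤ.- + 1))
      ≡⟨ cong₂ _+_ (cong₂ _+_ shift₁ extend₂) shift₃ ⟩
    pairing L M W₁ + pairing L M W₂ + pairing L M W₃ ∎
    where
    A B : ℤ → ℚ
    A i = q²^ (+ L ℤ.+ + 1 ℤ.+ i)
    B i = q²^ (+ L ℤ.+ + 1 ℤ.+ i) * q²^ (+ L ℤ.- i) + q²^ (+ L ℤ.+ i)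
    W₁ W₂ W₃ : ℤ → ℤ → ℚ
    W₁ i j = q²^ (+ L ℤ.+ i) * w (i ℤ.- + 1) j
    W₂ i j = (q^ (+ 4 ℤ.* + L ℤ.+ + 2) + q²^ (+ L ℤ.+ i)) * w i j
    W₃ i j = w (i ℤ.+ + 1) j
    row : (ℤ → ℤ → ℚ) → ℤ → ℚ
    row W i = sumSym M (λ j → W i j * central L i * central M j)

    B≡ : ∀ i → B i ≡ q^ (+ 4 ℤ.* + L ℤ.+ + 2) + q²^ (+ L ℤ.+ i)
    B≡ i = cong (_+ q²^ (+ L ℤ.+ i))
      (q^-merge (+ L ℤ.+ + 1 ℤ.+ i ℤ.+ (+ L ℤ.+ + 1 ℤ.+ i)) (+ L ℤ.- i ℤ.+ (+ L ℤ.- i)) (exponent (+ L) i))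
      where
      exponent : ∀ x i → x ℤ.+ + 1 ℤ.+ i ℤ.+ (x ℤ.+ + 1 ℤ.+ i) ℤ.+ (x ℤ.- i ℤ.+ (x ℤ.- i)) ≡ + 4 ℤ.* x ℤ.+ + 2
      exponent = ℤ-Solver.solve-∀

    pointwise : ∀ i j →
      w i j * (A i * central L (i ℤ.+ + 1) + B i * central L i + central L (i ℤ.- + 1)) * central M j ≡
      W₁ (i ℤ.+ + 1) j * central L (i ℤ.+ + 1) * central M j + W₂ i j * central L i * central M j
      + W₃ (i ℤ.- + 1) j * central L (i ℤ.- + 1) * central M j
    pointwise i j = begin
      w i j * (A i * c₊ + B i * c₀ + c₋) * m
        ≡⟨ distribute (w i j) (A i) c₊ (B i) c₀ c₋ m ⟩
      A i * w i j * c₊ * m + B i * w i j * c₀ * m + w i j * c₋ * m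
        ≡⟨ cong₂ (λ x y → q²^ x * w i j * c₊ * m + y * w i j * c₀ * m + w i j * c₋ * m)
                 (reassociate (+ L) i) (B≡ i) ⟩
      q²^ (+ L ℤ.+ (i ℤ.+ + 1)) * w i j * c₊ * m + W₂ i j * c₀ * m + w i j * c₋ * m
        ≡⟨ cong₂ (λ x y → q²^ (+ L ℤ.+ (i ℤ.+ + 1)) * w x j * c₊ * m + W₂ i j * c₀ * m + w y j * c₋ * m)
                 (i≡i+1-1 i) (i≡i-1+1 i) ⟩
      W₁ (i ℤ.+ + 1) j * c₊ * m + W₂ i j * c₀ * m + W₃ (i ℤ.- + 1) j * c₋ * m ∎
      where
      c₊ = central L (i ℤ.+ + 1)
      c₀ = central L i
      c₋ = central L (i ℤ.- + 1)
      m = central M j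
      distribute : ∀ w a x b y z m → w * (a * x + b * y + z) * m ≡ a * w * x * m + b * w * y * m + w * z * m
      distribute = solve-∀ ℚ-ring
      reassociate : ∀ x i → x ℤ.+ + 1 ℤ.+ i ≡ x ℤ.+ (i ℤ.+ + 1)
      reassociate = ℤ-Solver.solve-∀
      i≡i+1-1 : ∀ i → i ≡ i ℤ.+ + 1 ℤ.- + 1
      i≡i+1-1 = ℤ-Solver.solve-∀
      i≡i-1+1 : ∀ i → i ≡ i ℤ.- + 1 ℤ.+ + 1
      i≡i-1+1 = ℤ-Solver.solve-∀

    split : ∀ i →
      sumSym M (λ j → w i j * (A i * central L (i ℤ.+ + 1) + B i * central L i + central L (i ℤ.- + 1)) * central M j)
      ≡ row W₁ (i ℤ.+ + 1) + row W₂ i + row W₃ (i ℤ.- + 1)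
    split i = trans (sumSym-cong M (pointwise i)) (trans (sumSym-+ M _ _) (cong (_+ row W₃ (i ℤ.- + 1)) (sumSym-+ M _ _)))

    shift₁ : sumSym (suc L) (λ i → row W₁ (i ℤ.+ + 1)) ≡ pairing L M W₁
    shift₁ = sumSym-shift-suc L (row W₁)
      (row-vanishes L M W₁ (+ suc L) (central-above L 0)) (row-vanishes L M W₁ (+ suc (suc L)) (central-above L 1))
    extend₂ : sumSym (suc L) (row W₂) ≡ pairing L M W₂
    extend₂ = sumSym-extend L (row W₂)
      (row-vanishes L M W₂ -[1+ L ] (central-below L 0)) (row-vanishes L M W₂ (+ suc L) (central-above L 0))
    shift₃ : sumSym (suc L) (λ i → row W₃ (i ℤ.- + 1)) ≡ pairing L M W₃
    shift₃ = sumSym-shift-pred L (row W₃)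
      (row-vanishes L M W₃ -[1+ L ] (central-below L 0)) (row-vanishes L M W₃ -[1+ suc L ] (central-below L 1))

  θ-twisted : ℤ → ℤ → ℚ
  θ-twisted i j = θ (i ℤ.+ j) * q^ (j ℤ.- i)

  S T : ℕ → ℕ → ℚ
  S L M = pairing L M (λ i j → θ (i ℤ.+ j))
  T L M = pairing L M θ-twisted

  S-comm : ∀ L M → S L M ≡ S M L
  S-comm L M = trans (pairing-swap L M (λ i j → θ (i ℤ.+ j))) (pairing-cong M L (λ i j → cong θ (ℤP.+-comm j i)))

  pairing-θ-twist : ∀ L M → pairing L M (λ i j → θ (i ℤ.+ j) * q^ (i ℤ.- j)) ≡ T M L
  pairing-θ-twist L M = trans (pairing-swap L M (λ i j → θ (i ℤ.+ j) * q^ (i ℤ.- j)))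
    (pairing-cong M L (λ i j → cong (λ k → θ k * q^ (j ℤ.- i)) (ℤP.+-comm j i)))

  pairing-θ-shift : ∀ L M → pairing L M (λ i j → θ (i ℤ.+ + 1 ℤ.+ j)) ≡ - S L M
  pairing-θ-shift L M = begin
    pairing L M (λ i j → θ (i ℤ.+ + 1 ℤ.+ j))
      ≡⟨ pairing-reflect L M (λ i j → θ (i ℤ.+ + 1 ℤ.+ j)) ⟩
    pairing L M (λ i j → θ (ℤ.- i ℤ.+ + 1 ℤ.+ ℤ.- j))
      ≡⟨ pairing-cong L M (λ i j → trans (cong θ (index i j)) (θ-1-k (i ℤ.+ j))) ⟩
    pairing L M (λ i j → - θ (i ℤ.+ j))
      ≡⟨ pairing-neg L M (λ i j → θ (i ℤ.+ j)) ⟩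
    - S L M ∎
    where
    index : ∀ i j → ℤ.- i ℤ.+ + 1 ℤ.+ ℤ.- j ≡ + 1 ℤ.- (i ℤ.+ j)
    index = ℤ-Solver.solve-∀

  pairing-q²^θ : ∀ L M → pairing L M (λ i j → q²^ (+ L ℤ.+ i) * θ (i ℤ.+ j)) ≡ q^ (+ 2 ℤ.* + L) * T L M
  pairing-q²^θ L M = begin
    pairing L M (λ i j → q²^ (+ L ℤ.+ i) * θ (i ℤ.+ j))
      ≡⟨ pairing-reflect L M (λ i j → q²^ (+ L ℤ.+ i) * θ (i ℤ.+ j)) ⟩
    pairing L M (λ i j → q²^ (+ L ℤ.+ ℤ.- i) * θ (ℤ.- i ℤ.+ ℤ.- j))
      ≡⟨ pairing-cong L M pointwise ⟩
    pairing L M (λ i j → q^ (+ 2 ℤ.* + L) * (θ (i ℤ.+ j) * q^ (j ℤ.- i)))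
      ≡⟨ pairing-*ˡ L M (q^ (+ 2 ℤ.* + L)) (λ i j → θ (i ℤ.+ j) * q^ (j ℤ.- i)) ⟩
    q^ (+ 2 ℤ.* + L) * T L M ∎
    where
    pointwise : ∀ i j → q²^ (+ L ℤ.+ ℤ.- i) * θ (ℤ.- i ℤ.+ ℤ.- j) ≡ q^ (+ 2 ℤ.* + L) * (θ (i ℤ.+ j) * q^ (j ℤ.- i))
    pointwise i j = begin
      q²^ (+ L ℤ.+ ℤ.- i) * θ (ℤ.- i ℤ.+ ℤ.- j)
        ≡⟨ cong (λ k → q²^ (+ L ℤ.+ ℤ.- i) * θ k) (sym (ℤP.neg-distrib-+ i j)) ⟩
      q²^ (+ L ℤ.+ ℤ.- i) * θ (ℤ.- (i ℤ.+ j))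
        ≡⟨ cong (q²^ (+ L ℤ.+ ℤ.- i) *_) (θ-neg (i ℤ.+ j)) ⟩
      q²^ (+ L ℤ.+ ℤ.- i) * (q^ (i ℤ.+ j) * θ (i ℤ.+ j))
        ≡⟨ sym (ℚP.*-assoc (q²^ (+ L ℤ.+ ℤ.- i)) (q^ (i ℤ.+ j)) (θ (i ℤ.+ j))) ⟩
      q²^ (+ L ℤ.+ ℤ.- i) * q^ (i ℤ.+ j) * θ (i ℤ.+ j)
        ≡⟨ cong (_* θ (i ℤ.+ j)) (trans (q^-merge (+ L ℤ.+ ℤ.- i ℤ.+ (+ L ℤ.+ ℤ.- i)) (i ℤ.+ j) (exponent (+ L) i j))
                                       (q^-+ (+ 2 ℤ.* + L) (j ℤ.- i))) ⟩
      q^ (+ 2 ℤ.* + L) * q^ (j ℤ.- i) * θ (i ℤ.+ j)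
        ≡⟨ x*y*z≡x*[z*y] (q^ (+ 2 ℤ.* + L)) (q^ (j ℤ.- i)) (θ (i ℤ.+ j)) ⟩
      q^ (+ 2 ℤ.* + L) * (θ (i ℤ.+ j) * q^ (j ℤ.- i)) ∎
      where
      exponent : ∀ x i j → x ℤ.+ ℤ.- i ℤ.+ (x ℤ.+ ℤ.- i) ℤ.+ (i ℤ.+ j) ≡ + 2 ℤ.* x ℤ.+ (j ℤ.- i)
      exponent = ℤ-Solver.solve-∀

  pairing-q^θ : ∀ L M → pairing L M (λ i j → q^ (+ 2 ℤ.* + L ℤ.+ (i ℤ.+ j)) * θ (i ℤ.+ j)) ≡ q^ (+ 2 ℤ.* + L) * S L M
  pairing-q^θ L M = begin
    pairing L M (λ i j → q^ (+ 2 ℤ.* + L ℤ.+ (i ℤ.+ j)) * θ (i ℤ.+ j))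
      ≡⟨ pairing-reflect L M (λ i j → q^ (+ 2 ℤ.* + L ℤ.+ (i ℤ.+ j)) * θ (i ℤ.+ j)) ⟩
    pairing L M (λ i j → q^ (+ 2 ℤ.* + L ℤ.+ (ℤ.- i ℤ.+ ℤ.- j)) * θ (ℤ.- i ℤ.+ ℤ.- j))
      ≡⟨ pairing-cong L M pointwise ⟩
    pairing L M (λ i j → q^ (+ 2 ℤ.* + L) * θ (i ℤ.+ j))
      ≡⟨ pairing-*ˡ L M (q^ (+ 2 ℤ.* + L)) (λ i j → θ (i ℤ.+ j)) ⟩
    q^ (+ 2 ℤ.* + L) * S L M ∎
    where
    pointwise : ∀ i j → q^ (+ 2 ℤ.* + L ℤ.+ (ℤ.- i ℤ.+ ℤ.- j)) * θ (ℤ.- i ℤ.+ ℤ.- j) ≡ q^ (+ 2 ℤ.* + L) * θ (i ℤ.+ j)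
    pointwise i j = begin
      q^ (+ 2 ℤ.* + L ℤ.+ (ℤ.- i ℤ.+ ℤ.- j)) * θ (ℤ.- i ℤ.+ ℤ.- j)
        ≡⟨ cong (λ k → q^ (+ 2 ℤ.* + L ℤ.+ k) * θ k) (sym (ℤP.neg-distrib-+ i j)) ⟩
      q^ (+ 2 ℤ.* + L ℤ.+ ℤ.- (i ℤ.+ j)) * θ (ℤ.- (i ℤ.+ j))
        ≡⟨ cong (q^ (+ 2 ℤ.* + L ℤ.+ ℤ.- (i ℤ.+ j)) *_) (θ-neg (i ℤ.+ j)) ⟩
      q^ (+ 2 ℤ.* + L ℤ.+ ℤ.- (i ℤ.+ j)) * (q^ (i ℤ.+ j) * θ (i ℤ.+ j))
        ≡⟨ sym (ℚP.*-assoc (q^ (+ 2 ℤ.* + L ℤ.+ ℤ.- (i ℤ.+ j))) (q^ (i ℤ.+ j)) (θ (i ℤ.+ j))) ⟩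
      q^ (+ 2 ℤ.* + L ℤ.+ ℤ.- (i ℤ.+ j)) * q^ (i ℤ.+ j) * θ (i ℤ.+ j)
        ≡⟨ cong (_* θ (i ℤ.+ j)) (q^-merge (+ 2 ℤ.* + L ℤ.+ ℤ.- (i ℤ.+ j)) (i ℤ.+ j) (exponent (+ 2 ℤ.* + L) (i ℤ.+ j))) ⟩
      q^ (+ 2 ℤ.* + L) * θ (i ℤ.+ j) ∎
      where
      exponent : ∀ x k → x ℤ.+ ℤ.- k ℤ.+ k ≡ x
      exponent = ℤ-Solver.solve-∀

  pairing-[c+f]* : ∀ L M c (f : ℤ → ℚ) (w : ℤ → ℤ → ℚ) →
    pairing L M (λ i j → (c + f i) * w i j) ≡ c * pairing L M w + pairing L M (λ i j → f i * w i j)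
  pairing-[c+f]* L M c f w = begin
    pairing L M (λ i j → (c + f i) * w i j)
      ≡⟨ pairing-cong L M (λ i j → ℚP.*-distribʳ-+ (w i j) c (f i)) ⟩
    pairing L M (λ i j → c * w i j + f i * w i j)
      ≡⟨ pairing-+ L M (λ i j → c * w i j) (λ i j → f i * w i j) ⟩
    pairing L M (λ i j → c * w i j) + pairing L M (λ i j → f i * w i j)
      ≡⟨ cong (_+ pairing L M (λ i j → f i * w i j)) (pairing-*ˡ L M c w) ⟩
    c * pairing L M w + pairing L M (λ i j → f i * w i j) ∎

  pairing-θ-pred : ∀ L M →
    pairing L M (λ i j → q²^ (+ L ℤ.+ i) * θ (i ℤ.- + 1 ℤ.+ j)) ≡ - (q^ (+ 2 ℤ.* + L ℤ.+ + 1) * T M L)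
  pairing-θ-pred L M = begin
    pairing L M (λ i j → q²^ (+ L ℤ.+ i) * θ (i ℤ.- + 1 ℤ.+ j))
      ≡⟨ pairing-cong L M pointwise ⟩
    pairing L M (λ i j → - (c * (θ (i ℤ.+ j) * q^ (i ℤ.- j))))
      ≡⟨ pairing-neg L M (λ i j → c * (θ (i ℤ.+ j) * q^ (i ℤ.- j))) ⟩
    - pairing L M (λ i j → c * (θ (i ℤ.+ j) * q^ (i ℤ.- j)))
      ≡⟨ cong -_ (pairing-*ˡ L M c (λ i j → θ (i ℤ.+ j) * q^ (i ℤ.- j))) ⟩
    - (c * pairing L M (λ i j → θ (i ℤ.+ j) * q^ (i ℤ.- j)))
      ≡⟨ cong (λ x → - (c * x)) (pairing-θ-twist L M) ⟩
    - (c * T M L) ∎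
    where
    c = q^ (+ 2 ℤ.* + L ℤ.+ + 1)
    pointwise : ∀ i j → q²^ (+ L ℤ.+ i) * θ (i ℤ.- + 1 ℤ.+ j) ≡ - (c * (θ (i ℤ.+ j) * q^ (i ℤ.- j)))
    pointwise i j = begin
      q²^ (+ L ℤ.+ i) * θ (i ℤ.- + 1 ℤ.+ j)
        ≡⟨ cong (λ k → q²^ (+ L ℤ.+ i) * θ k) (reorder i j) ⟩
      q²^ (+ L ℤ.+ i) * θ (i ℤ.+ j ℤ.- + 1)
        ≡⟨ cong (q²^ (+ L ℤ.+ i) *_) (θ-pred (i ℤ.+ j)) ⟩
      q²^ (+ L ℤ.+ i) * - (q^ (+ 1 ℤ.- (i ℤ.+ j)) * θ (i ℤ.+ j))
        ≡⟨ pull-out (q²^ (+ L ℤ.+ i)) (q^ (+ 1 ℤ.- (i ℤ.+ j))) (θ (i ℤ.+ j)) ⟩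
      - (q²^ (+ L ℤ.+ i) * q^ (+ 1 ℤ.- (i ℤ.+ j)) * θ (i ℤ.+ j))
        ≡⟨ cong (λ x → - (x * θ (i ℤ.+ j)))
                (trans (q^-merge (+ L ℤ.+ i ℤ.+ (+ L ℤ.+ i)) (+ 1 ℤ.- (i ℤ.+ j)) (exponent (+ L) i j))
                       (q^-+ (+ 2 ℤ.* + L ℤ.+ + 1) (i ℤ.- j))) ⟩
      - (c * q^ (i ℤ.- j) * θ (i ℤ.+ j))
        ≡⟨ cong -_ (x*y*z≡x*[z*y] c (q^ (i ℤ.- j)) (θ (i ℤ.+ j))) ⟩
      - (c * (θ (i ℤ.+ j) * q^ (i ℤ.- j))) ∎
      where
      reorder : ∀ i j → i ℤ.- + 1 ℤ.+ j ≡ i ℤ.+ j ℤ.- + 1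
      reorder = ℤ-Solver.solve-∀
      exponent : ∀ x i j → x ℤ.+ i ℤ.+ (x ℤ.+ i) ℤ.+ (+ 1 ℤ.- (i ℤ.+ j)) ≡ + 2 ℤ.* x ℤ.+ + 1 ℤ.+ (i ℤ.- j)
      exponent = ℤ-Solver.solve-∀
      pull-out : ∀ a b c → a * - (b * c) ≡ - (a * b * c)
      pull-out = solve-∀ ℚ-ring

  S-suc : ∀ L M → S (suc L) M ≡
    - (q^ (+ 2 ℤ.* + L ℤ.+ + 1) * T M L)
    + (q^ (+ 4 ℤ.* + L ℤ.+ + 2) * S L M + q^ (+ 2 ℤ.* + L) * T L M)
    + - S L M
  S-suc L M = begin
    S (suc L) M
      ≡⟨ pairing-suc L M (λ i j → θ (i ℤ.+ j)) ⟩
    pairing L M (λ i j → q²^ (+ L ℤ.+ i) * θ (i ℤ.- + 1 ℤ.+ j))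
      + pairing L M (λ i j → (Q + q²^ (+ L ℤ.+ i)) * θ (i ℤ.+ j))
      + pairing L M (λ i j → θ (i ℤ.+ + 1 ℤ.+ j))
      ≡⟨ cong₂ _+_ (cong₂ _+_ (pairing-θ-pred L M) middle) (pairing-θ-shift L M) ⟩
    - (q^ (+ 2 ℤ.* + L ℤ.+ + 1) * T M L) + (Q * S L M + q^ (+ 2 ℤ.* + L) * T L M) + - S L M ∎
    where
    Q = q^ (+ 4 ℤ.* + L ℤ.+ + 2)
    middle : pairing L M (λ i j → (Q + q²^ (+ L ℤ.+ i)) * θ (i ℤ.+ j)) ≡ Q * S L M + q^ (+ 2 ℤ.* + L) * T L M
    middle = trans (pairing-[c+f]* L M Q (λ i → q²^ (+ L ℤ.+ i)) (λ i j → θ (i ℤ.+ j)))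
                   (cong (λ x → Q * S L M + x) (pairing-q²^θ L M))

  pairing-twisted-pred : ∀ L M →
    pairing L M (λ i j → q²^ (+ L ℤ.+ i) * θ-twisted (i ℤ.- + 1) j) ≡ - (q^ (+ 2 ℤ.* + L ℤ.+ + 2) * S L M)
  pairing-twisted-pred L M = begin
    pairing L M (λ i j → q²^ (+ L ℤ.+ i) * θ-twisted (i ℤ.- + 1) j)
      ≡⟨ pairing-cong L M pointwise ⟩
    pairing L M (λ i j → - (c * θ (i ℤ.+ j)))
      ≡⟨ pairing-neg L M (λ i j → c * θ (i ℤ.+ j)) ⟩
    - pairing L M (λ i j → c * θ (i ℤ.+ j))
      ≡⟨ cong -_ (pairing-*ˡ L M c (λ i j → θ (i ℤ.+ j))) ⟩
    - (c * S L M) ∎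
    where
    c = q^ (+ 2 ℤ.* + L ℤ.+ + 2)
    pointwise : ∀ i j → q²^ (+ L ℤ.+ i) * θ-twisted (i ℤ.- + 1) j ≡ - (c * θ (i ℤ.+ j))
    pointwise i j = begin
      q²^ (+ L ℤ.+ i) * (θ (i ℤ.- + 1 ℤ.+ j) * q^ (j ℤ.- (i ℤ.- + 1)))
        ≡⟨ cong (λ k → q²^ (+ L ℤ.+ i) * (θ k * q^ (j ℤ.- (i ℤ.- + 1)))) (reorder i j) ⟩
      q²^ (+ L ℤ.+ i) * (θ (i ℤ.+ j ℤ.- + 1) * q^ (j ℤ.- (i ℤ.- + 1)))
        ≡⟨ cong (λ x → q²^ (+ L ℤ.+ i) * (x * q^ (j ℤ.- (i ℤ.- + 1)))) (θ-pred (i ℤ.+ j)) ⟩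
      q²^ (+ L ℤ.+ i) * (- (q^ (+ 1 ℤ.- (i ℤ.+ j)) * θ (i ℤ.+ j)) * q^ (j ℤ.- (i ℤ.- + 1)))
        ≡⟨ pull-out (q²^ (+ L ℤ.+ i)) (q^ (+ 1 ℤ.- (i ℤ.+ j))) (θ (i ℤ.+ j)) (q^ (j ℤ.- (i ℤ.- + 1))) ⟩
      - (q²^ (+ L ℤ.+ i) * q^ (+ 1 ℤ.- (i ℤ.+ j)) * q^ (j ℤ.- (i ℤ.- + 1)) * θ (i ℤ.+ j))
        ≡⟨ cong (λ x → - (x * θ (i ℤ.+ j)))
             (trans (cong (_* q^ (j ℤ.- (i ℤ.- + 1))) (q^-merge (+ L ℤ.+ i ℤ.+ (+ L ℤ.+ i)) (+ 1 ℤ.- (i ℤ.+ j)) refl))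
                    (q^-merge (+ L ℤ.+ i ℤ.+ (+ L ℤ.+ i) ℤ.+ (+ 1 ℤ.- (i ℤ.+ j))) (j ℤ.- (i ℤ.- + 1)) (exponent (+ L) i j))) ⟩
      - (c * θ (i ℤ.+ j)) ∎
      where
      reorder : ∀ i j → i ℤ.- + 1 ℤ.+ j ≡ i ℤ.+ j ℤ.- + 1
      reorder = ℤ-Solver.solve-∀
      exponent : ∀ x i j → x ℤ.+ i ℤ.+ (x ℤ.+ i) ℤ.+ (+ 1 ℤ.- (i ℤ.+ j)) ℤ.+ (j ℤ.- (i ℤ.- + 1)) ≡ + 2 ℤ.* x ℤ.+ + 2
      exponent = ℤ-Solver.solve-∀
      pull-out : ∀ a b t d → a * (- (b * t) * d) ≡ - (a * b * d * t)
      pull-out = solve-∀ ℚ-ring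

  pairing-q²^twisted : ∀ L M → pairing L M (λ i j → q²^ (+ L ℤ.+ i) * θ-twisted i j) ≡ q^ (+ 2 ℤ.* + L) * S L M
  pairing-q²^twisted L M = trans (pairing-cong L M pointwise) (pairing-q^θ L M)
    where
    pointwise : ∀ i j → q²^ (+ L ℤ.+ i) * θ-twisted i j ≡ q^ (+ 2 ℤ.* + L ℤ.+ (i ℤ.+ j)) * θ (i ℤ.+ j)
    pointwise i j = begin
      q²^ (+ L ℤ.+ i) * (θ (i ℤ.+ j) * q^ (j ℤ.- i))
        ≡⟨ x*[y*z]≡x*z*y (q²^ (+ L ℤ.+ i)) (θ (i ℤ.+ j)) (q^ (j ℤ.- i)) ⟩
      q²^ (+ L ℤ.+ i) * q^ (j ℤ.- i) * θ (i ℤ.+ j)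
        ≡⟨ cong (_* θ (i ℤ.+ j)) (q^-merge (+ L ℤ.+ i ℤ.+ (+ L ℤ.+ i)) (j ℤ.- i) (exponent (+ L) i j)) ⟩
      q^ (+ 2 ℤ.* + L ℤ.+ (i ℤ.+ j)) * θ (i ℤ.+ j) ∎
      where
      exponent : ∀ x i j → x ℤ.+ i ℤ.+ (x ℤ.+ i) ℤ.+ (j ℤ.- i) ≡ + 2 ℤ.* x ℤ.+ (i ℤ.+ j)
      exponent = ℤ-Solver.solve-∀
      x*[y*z]≡x*z*y : ∀ x y z → x * (y * z) ≡ x * z * y
      x*[y*z]≡x*z*y = solve-∀ ℚ-ring

  pairing-twisted-shift : ∀ L M → pairing L M (λ i j → θ-twisted (i ℤ.+ + 1) j) ≡ - (q^ (ℤ.- + 1) * T M L)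
  pairing-twisted-shift L M = begin
    pairing L M (λ i j → θ-twisted (i ℤ.+ + 1) j)
      ≡⟨ pairing-reflect L M (λ i j → θ-twisted (i ℤ.+ + 1) j) ⟩
    pairing L M (λ i j → θ-twisted (ℤ.- i ℤ.+ + 1) (ℤ.- j))
      ≡⟨ pairing-cong L M pointwise ⟩
    pairing L M (λ i j → - (q^ (ℤ.- + 1) * (θ (i ℤ.+ j) * q^ (i ℤ.- j))))
      ≡⟨ pairing-neg L M (λ i j → q^ (ℤ.- + 1) * (θ (i ℤ.+ j) * q^ (i ℤ.- j))) ⟩
    - pairing L M (λ i j → q^ (ℤ.- + 1) * (θ (i ℤ.+ j) * q^ (i ℤ.- j)))
      ≡⟨ cong -_ (pairing-*ˡ L M (q^ (ℤ.- + 1)) (λ i j → θ (i ℤ.+ j) * q^ (i ℤ.- j))) ⟩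
    - (q^ (ℤ.- + 1) * pairing L M (λ i j → θ (i ℤ.+ j) * q^ (i ℤ.- j)))
      ≡⟨ cong (λ x → - (q^ (ℤ.- + 1) * x)) (pairing-θ-twist L M) ⟩
    - (q^ (ℤ.- + 1) * T M L) ∎
    where
    pointwise : ∀ i j → θ-twisted (ℤ.- i ℤ.+ + 1) (ℤ.- j) ≡ - (q^ (ℤ.- + 1) * (θ (i ℤ.+ j) * q^ (i ℤ.- j)))
    pointwise i j = begin
      θ (ℤ.- i ℤ.+ + 1 ℤ.+ ℤ.- j) * q^ (ℤ.- j ℤ.- (ℤ.- i ℤ.+ + 1))
        ≡⟨ cong₂ (λ k l → θ k * q^ l) (index₁ i j) (index₂ i j) ⟩
      θ (+ 1 ℤ.- (i ℤ.+ j)) * q^ (ℤ.- + 1 ℤ.+ (i ℤ.- j))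
        ≡⟨ cong₂ _*_ (θ-1-k (i ℤ.+ j)) (q^-+ (ℤ.- + 1) (i ℤ.- j)) ⟩
      (- θ (i ℤ.+ j)) * (q^ (ℤ.- + 1) * q^ (i ℤ.- j))
        ≡⟨ rearrange (θ (i ℤ.+ j)) (q^ (ℤ.- + 1)) (q^ (i ℤ.- j)) ⟩
      - (q^ (ℤ.- + 1) * (θ (i ℤ.+ j) * q^ (i ℤ.- j))) ∎
      where
      index₁ : ∀ i j → ℤ.- i ℤ.+ + 1 ℤ.+ ℤ.- j ≡ + 1 ℤ.- (i ℤ.+ j)
      index₁ = ℤ-Solver.solve-∀
      index₂ : ∀ i j → ℤ.- j ℤ.- (ℤ.- i ℤ.+ + 1) ≡ ℤ.- + 1 ℤ.+ (i ℤ.- j)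
      index₂ = ℤ-Solver.solve-∀
      rearrange : ∀ t a b → (- t) * (a * b) ≡ - (a * (t * b))
      rearrange = solve-∀ ℚ-ring

  T-suc : ∀ L M → T (suc L) M ≡
    - (q^ (+ 2 ℤ.* + L ℤ.+ + 2) * S L M)
    + (q^ (+ 4 ℤ.* + L ℤ.+ + 2) * T L M + q^ (+ 2 ℤ.* + L) * S L M)
    + - (q^ (ℤ.- + 1) * T M L)
  T-suc L M = begin
    T (suc L) M
      ≡⟨ pairing-suc L M θ-twisted ⟩
    pairing L M (λ i j → q²^ (+ L ℤ.+ i) * θ-twisted (i ℤ.- + 1) j)
      + pairing L M (λ i j → (Q + q²^ (+ L ℤ.+ i)) * θ-twisted i j)
      + pairing L M (λ i j → θ-twisted (i ℤ.+ + 1) j)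
      ≡⟨ cong₂ _+_ (cong₂ _+_ (pairing-twisted-pred L M) middle) (pairing-twisted-shift L M) ⟩
    - (q^ (+ 2 ℤ.* + L ℤ.+ + 2) * S L M) + (Q * T L M + q^ (+ 2 ℤ.* + L) * S L M) + - (q^ (ℤ.- + 1) * T M L) ∎
    where
    Q = q^ (+ 4 ℤ.* + L ℤ.+ + 2)
    middle : pairing L M (λ i j → (Q + q²^ (+ L ℤ.+ i)) * θ-twisted i j) ≡ Q * T L M + q^ (+ 2 ℤ.* + L) * S L M
    middle = trans (pairing-[c+f]* L M Q (λ i → q²^ (+ L ℤ.+ i)) θ-twisted)
                   (cong (λ x → Q * T L M + x) (pairing-q²^twisted L M))

  T-zero : ∀ M → T 0 M ≡ S 0 M
  T-zero M = cong (λ x → 0ℚ + x) (trans (sym (sumSym-reflect M (λ j → term j))) (sumSym-cong M pointwise))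
    where
    c₀ = central 0 (+ 0)
    term : ℤ → ℚ
    term j = θ (+ 0 ℤ.+ j) * q^ (j ℤ.- + 0) * c₀ * central M j
    pointwise : ∀ j → term (ℤ.- j) ≡ θ (+ 0 ℤ.+ j) * c₀ * central M j
    pointwise j = begin
      θ (+ 0 ℤ.+ ℤ.- j) * q^ (ℤ.- j ℤ.- + 0) * c₀ * central M (ℤ.- j)
        ≡⟨ cong₂ (λ k l → θ k * q^ l * c₀ * central M (ℤ.- j)) (ℤP.+-identityˡ (ℤ.- j)) (ℤP.+-identityʳ (ℤ.- j)) ⟩
      θ (ℤ.- j) * q^ (ℤ.- j) * c₀ * central M (ℤ.- j)
        ≡⟨ cong₂ (λ x y → x * q^ (ℤ.- j) * c₀ * y) (θ-neg j) (central-reflect M j) ⟩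
      q^ j * θ j * q^ (ℤ.- j) * c₀ * central M j
        ≡⟨ rearrange (q^ j) (θ j) (q^ (ℤ.- j)) c₀ (central M j) ⟩
      q^ (ℤ.- j) * q^ j * θ j * c₀ * central M j
        ≡⟨ cong (λ x → x * θ j * c₀ * central M j) (q^-inverse j) ⟩
      1ℚ * θ j * c₀ * central M j
        ≡⟨ cong (λ x → x * c₀ * central M j) (trans (ℚP.*-identityˡ (θ j)) (cong θ (sym (ℤP.+-identityˡ j)))) ⟩
      θ (+ 0 ℤ.+ j) * c₀ * central M j ∎
      where
      rearrange : ∀ a t b u v → a * t * b * u * v ≡ b * a * t * u * v
      rearrange = solve-∀ ℚ-ring

  C : ℕ → ℕ → ℚ
  C L M = negOnePow (+ (M ℕ.+ L)) * (q ^ℚ (∣ + L ℤ.- + M ∣ ℕ.^ 2)) * qPoch q (q ^ℚ 2) (L ℕ.+ M)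

  C≡ : ∀ L M → C L M ≡ negOnePow (+ (M ℕ.+ L)) * q^ ((+ L ℤ.- + M) ℤ.* (+ L ℤ.- + M)) * qPoch q (q ^ℚ 2) (L ℕ.+ M)
  C≡ L M = cong (λ e → negOnePow (+ (M ℕ.+ L)) * q^ e * qPoch q (q ^ℚ 2) (L ℕ.+ M)) (+∣x∣^2≡x*x (+ L ℤ.- + M))

  C-comm : ∀ L M → C L M ≡ C M L
  C-comm L M = begin
    C L M
      ≡⟨ C≡ L M ⟩
    negOnePow (+ (M ℕ.+ L)) * q^ ((+ L ℤ.- + M) ℤ.* (+ L ℤ.- + M)) * qPoch q (q ^ℚ 2) (L ℕ.+ M)
      ≡⟨ cong₂ (λ n e → negOnePow (+ n) * q^ e * qPoch q (q ^ℚ 2) (L ℕ.+ M)) (ℕP.+-comm M L) (square-flip (+ L) (+ M)) ⟩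
    negOnePow (+ (L ℕ.+ M)) * q^ ((+ M ℤ.- + L) ℤ.* (+ M ℤ.- + L)) * qPoch q (q ^ℚ 2) (L ℕ.+ M)
      ≡⟨ cong (λ n → negOnePow (+ (L ℕ.+ M)) * q^ ((+ M ℤ.- + L) ℤ.* (+ M ℤ.- + L)) * qPoch q (q ^ℚ 2) n) (ℕP.+-comm L M) ⟩
    negOnePow (+ (L ℕ.+ M)) * q^ ((+ M ℤ.- + L) ℤ.* (+ M ℤ.- + L)) * qPoch q (q ^ℚ 2) (M ℕ.+ L)
      ≡⟨ sym (C≡ M L) ⟩
    C M L ∎
    where
    square-flip : ∀ x y → (x ℤ.- y) ℤ.* (x ℤ.- y) ≡ (y ℤ.- x) ℤ.* (y ℤ.- x)
    square-flip = ℤ-Solver.solve-∀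

  C-suc : ∀ L M → C (suc L) M ≡ (q^ (+ 4 ℤ.* + L ℤ.+ + 2) - q^ (+ 2 ℤ.* + L ℤ.- + 2 ℤ.* + M ℤ.+ + 1)) * C L M
  C-suc L M = begin
    C (suc L) M
      ≡⟨ C≡ (suc L) M ⟩
    negOnePow (+ (M ℕ.+ suc L)) * q^ ((+ suc L ℤ.- + M) ℤ.* (+ suc L ℤ.- + M)) * qPoch q (q ^ℚ 2) (suc L ℕ.+ M)
      ≡⟨ cong₂ (λ x y → x * y * qPoch q (q ^ℚ 2) (suc L ℕ.+ M)) sign square ⟩
    (- N) * (E * q^ r) * (P * (1ℚ - q * (q ^ℚ 2) ^ℚ (L ℕ.+ M)))
      ≡⟨ cong (λ z → (- N) * (E * q^ r) * (P * (1ℚ - z))) last-factor ⟩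
    (- N) * (E * q^ r) * (P * (1ℚ - q^ s))
      ≡⟨ regroup N E (q^ r) P (q^ s) ⟩
    (q^ r * q^ s - q^ r) * (N * E * P)
      ≡⟨ cong₂ (λ x y → (x - q^ r) * y) (q^-merge r s (r+s (+ L) (+ M))) (sym (C≡ L M)) ⟩
    (q^ (+ 4 ℤ.* + L ℤ.+ + 2) - q^ r) * C L M ∎
    where
    N = negOnePow (+ (M ℕ.+ L))
    E = q^ ((+ L ℤ.- + M) ℤ.* (+ L ℤ.- + M))
    P = qPoch q (q ^ℚ 2) (L ℕ.+ M)
    r = + 2 ℤ.* + L ℤ.- + 2 ℤ.* + M ℤ.+ + 1
    s = + 2 ℤ.* + L ℤ.+ + 2 ℤ.* + M ℤ.+ + 1
    regroup : ∀ N E a P b → (- N) * (E * a) * (P * (1ℚ - b)) ≡ (a * b - a) * (N * E * P)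
    regroup = solve-∀ ℚ-ring
    r+s : ∀ x y → (+ 2 ℤ.* x ℤ.- + 2 ℤ.* y ℤ.+ + 1) ℤ.+ (+ 2 ℤ.* x ℤ.+ + 2 ℤ.* y ℤ.+ + 1) ≡ + 4 ℤ.* x ℤ.+ + 2
    r+s = ℤ-Solver.solve-∀
    sign : negOnePow (+ (M ℕ.+ suc L)) ≡ - N
    sign = trans (cong (λ n → negOnePow (+ n)) (trans (ℕP.+-suc M L) (ℕP.+-comm 1 (M ℕ.+ L)))) (negOnePow-suc (+ (M ℕ.+ L)))
    square : q^ ((+ suc L ℤ.- + M) ℤ.* (+ suc L ℤ.- + M)) ≡ E * q^ r
    square = sym (q^-merge ((+ L ℤ.- + M) ℤ.* (+ L ℤ.- + M)) r (expand (+ L) (+ M)))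
      where
      expand : ∀ x y → (x ℤ.- y) ℤ.* (x ℤ.- y) ℤ.+ (+ 2 ℤ.* x ℤ.- + 2 ℤ.* y ℤ.+ + 1) ≡
                       (+ 1 ℤ.+ x ℤ.- y) ℤ.* (+ 1 ℤ.+ x ℤ.- y)
      expand = ℤ-Solver.solve-∀
    last-factor : q * (q ^ℚ 2) ^ℚ (L ℕ.+ M) ≡ q^ s
    last-factor = begin
      q * (q ^ℚ 2) ^ℚ (L ℕ.+ M)                  ≡⟨ cong₂ _*_ (sym (ℚP.*-identityʳ q)) (^2-^ q (L ℕ.+ M)) ⟩
      q^ (+ 1) * q^ (+ (L ℕ.+ M ℕ.+ (L ℕ.+ M)))  ≡⟨ q^-merge (+ 1) (+ (L ℕ.+ M ℕ.+ (L ℕ.+ M))) exponent ⟩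
      q^ s                                       ∎
      where
      exponent : + 1 ℤ.+ + (L ℕ.+ M ℕ.+ (L ℕ.+ M)) ≡ s
      exponent = trans (cong (λ z → + 1 ℤ.+ z) (trans (ℤP.pos-+ (L ℕ.+ M) (L ℕ.+ M)) (cong₂ ℤ._+_ (ℤP.pos-+ L M) (ℤP.pos-+ L M))))
                       (collect (+ L) (+ M))
        where
        collect : ∀ x y → + 1 ℤ.+ (x ℤ.+ y ℤ.+ (x ℤ.+ y)) ≡ + 2 ℤ.* x ℤ.+ + 2 ℤ.* y ℤ.+ + 1
        collect = ℤ-Solver.solve-∀

  Invariant : ℕ → ℕ → Set
  Invariant L M = S L M ≡ C L M × q^ (+ 2 ℤ.* + L) * T L M ≡ C L M

  S-step : ∀ L M → S L M ≡ C L M → q^ (+ 2 ℤ.* + L) * T L M ≡ C L M → q^ (+ 2 ℤ.* + M) * T M L ≡ C L M →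
    S (suc L) M ≡ C (suc L) M
  S-step L M S≡C aT≡C bT′≡C = begin
    S (suc L) M
      ≡⟨ S-suc L M ⟩
    - (q^ (+ 2 ℤ.* + L ℤ.+ + 1) * T M L) + (Q * S L M + a * T L M) + - S L M
      ≡⟨ cong (λ x → - (x * T M L) + (Q * S L M + a * T L M) + - S L M)
              (sym (q^-merge (+ 2 ℤ.* + L ℤ.- + 2 ℤ.* + M ℤ.+ + 1) (+ 2 ℤ.* + M) (exponent (+ L) (+ M)))) ⟩
    - (r * b * T M L) + (Q * S L M + a * T L M) + - S L M
      ≡⟨ regroup r b (T M L) Q (S L M) (a * T L M) ⟩
    Q * S L M + a * T L M - S L M - r * (b * T M L)
      ≡⟨ cong₂ (λ x y → Q * x + y - x - r * (b * T M L)) S≡C aT≡C ⟩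
    Q * C L M + C L M - C L M - r * (b * T M L)
      ≡⟨ cong (λ x → Q * C L M + C L M - C L M - r * x) bT′≡C ⟩
    Q * C L M + C L M - C L M - r * C L M
      ≡⟨ collect Q r (C L M) ⟩
    (Q - r) * C L M
      ≡⟨ sym (C-suc L M) ⟩
    C (suc L) M ∎
    where
    a = q^ (+ 2 ℤ.* + L)
    b = q^ (+ 2 ℤ.* + M)
    Q = q^ (+ 4 ℤ.* + L ℤ.+ + 2)
    r = q^ (+ 2 ℤ.* + L ℤ.- + 2 ℤ.* + M ℤ.+ + 1)
    exponent : ∀ x y → + 2 ℤ.* x ℤ.- + 2 ℤ.* y ℤ.+ + 1 ℤ.+ + 2 ℤ.* y ≡ + 2 ℤ.* x ℤ.+ + 1
    exponent = ℤ-Solver.solve-∀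
    regroup : ∀ r b t Q s u → - (r * b * t) + (Q * s + u) + - s ≡ Q * s + u - s - r * (b * t)
    regroup = solve-∀ ℚ-ring
    collect : ∀ Q r c → Q * c + c - c - r * c ≡ (Q - r) * c
    collect = solve-∀ ℚ-ring

  T-step : ∀ L M → S L M ≡ C L M → q^ (+ 2 ℤ.* + L) * T L M ≡ C L M → q^ (+ 2 ℤ.* + M) * T M L ≡ C L M →
    q^ (+ 2 ℤ.* + suc L) * T (suc L) M ≡ C (suc L) M
  T-step L M S≡C aT≡C bT′≡C = begin
    q^ (+ 2 ℤ.* + suc L) * T (suc L) M
      ≡⟨ cong₂ _*_ (cong q^ (e₀ (+ L))) (T-suc L M) ⟩
    d * (- (d * S L M) + (Q * T L M + a * S L M) + - (m * T M L))
      ≡⟨ expand d (S L M) Q (T L M) a m (T M L) ⟩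
    - (d * d * S L M) + d * Q * T L M + d * a * S L M - d * m * T M L
      ≡⟨ cong₂ (λ x y → - (x * S L M) + y * T L M + d * a * S L M - d * m * T M L)
               (q^-merge (+ 2 ℤ.* + L ℤ.+ + 2) (+ 2 ℤ.* + L ℤ.+ + 2) (e₁ (+ L)))
               (trans (q^-merge (+ 2 ℤ.* + L ℤ.+ + 2) (+ 4 ℤ.* + L ℤ.+ + 2) (e₂ (+ L)))
                      (q^-+ (+ 4 ℤ.* + L ℤ.+ + 4) (+ 2 ℤ.* + L))) ⟩
    - (R * S L M) + R * a * T L M + d * a * S L M - d * m * T M L
      ≡⟨ cong₂ (λ x y → - (R * S L M) + R * a * T L M + x * S L M - y * T M L)
               (q^-merge (+ 2 ℤ.* + L ℤ.+ + 2) (+ 2 ℤ.* + L) (e₃ (+ L)))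
               (trans (q^-merge (+ 2 ℤ.* + L ℤ.+ + 2) (ℤ.- + 1) (e₄ (+ L) (+ M)))
                      (q^-+ (+ 2 ℤ.* + L ℤ.- + 2 ℤ.* + M ℤ.+ + 1) (+ 2 ℤ.* + M))) ⟩
    - (R * S L M) + R * a * T L M + Q * S L M - r * b * T M L
      ≡⟨ regroup R (S L M) a (T L M) Q r b (T M L) ⟩
    - (R * S L M) + R * (a * T L M) + Q * S L M - r * (b * T M L)
      ≡⟨ cong₂ (λ x y → - (R * x) + R * y + Q * x - r * (b * T M L)) S≡C aT≡C ⟩
    - (R * C L M) + R * C L M + Q * C L M - r * (b * T M L)
      ≡⟨ cong (λ x → - (R * C L M) + R * C L M + Q * C L M - r * x) bT′≡C ⟩
    - (R * C L M) + R * C L M + Q * C L M - r * C L M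
      ≡⟨ collect R Q r (C L M) ⟩
    (Q - r) * C L M
      ≡⟨ sym (C-suc L M) ⟩
    C (suc L) M ∎
    where
    a = q^ (+ 2 ℤ.* + L)
    b = q^ (+ 2 ℤ.* + M)
    d = q^ (+ 2 ℤ.* + L ℤ.+ + 2)
    Q = q^ (+ 4 ℤ.* + L ℤ.+ + 2)
    R = q^ (+ 4 ℤ.* + L ℤ.+ + 4)
    r = q^ (+ 2 ℤ.* + L ℤ.- + 2 ℤ.* + M ℤ.+ + 1)
    m = q^ (ℤ.- + 1)
    expand : ∀ d s Q t a m t′ → d * (- (d * s) + (Q * t + a * s) + - (m * t′)) ≡
             - (d * d * s) + d * Q * t + d * a * s - d * m * t′
    expand = solve-∀ ℚ-ring
    regroup : ∀ R s a t Q r b t′ → - (R * s) + R * a * t + Q * s - r * b * t′ ≡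
              - (R * s) + R * (a * t) + Q * s - r * (b * t′)
    regroup = solve-∀ ℚ-ring
    collect : ∀ R Q r c → - (R * c) + R * c + Q * c - r * c ≡ (Q - r) * c
    collect = solve-∀ ℚ-ring
    e₀ : ∀ x → + 2 ℤ.* (+ 1 ℤ.+ x) ≡ + 2 ℤ.* x ℤ.+ + 2
    e₀ = ℤ-Solver.solve-∀
    e₁ : ∀ x → + 2 ℤ.* x ℤ.+ + 2 ℤ.+ (+ 2 ℤ.* x ℤ.+ + 2) ≡ + 4 ℤ.* x ℤ.+ + 4
    e₁ = ℤ-Solver.solve-∀
    e₂ : ∀ x → + 2 ℤ.* x ℤ.+ + 2 ℤ.+ (+ 4 ℤ.* x ℤ.+ + 2) ≡ + 4 ℤ.* x ℤ.+ + 4 ℤ.+ + 2 ℤ.* x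
    e₂ = ℤ-Solver.solve-∀
    e₃ : ∀ x → + 2 ℤ.* x ℤ.+ + 2 ℤ.+ + 2 ℤ.* x ≡ + 4 ℤ.* x ℤ.+ + 2
    e₃ = ℤ-Solver.solve-∀
    e₄ : ∀ x y → + 2 ℤ.* x ℤ.+ + 2 ℤ.+ ℤ.- + 1 ≡ + 2 ℤ.* x ℤ.- + 2 ℤ.* y ℤ.+ + 1 ℤ.+ + 2 ℤ.* y
    e₄ = ℤ-Solver.solve-∀

  invariant-suc : ∀ L M → Invariant L M → Invariant M L → Invariant (suc L) M
  invariant-suc L M (S≡C , aT≡C) (_ , bT′≡C′) = S-step L M S≡C aT≡C bT′≡C , T-step L M S≡C aT≡C bT′≡C
    where
    bT′≡C : q^ (+ 2 ℤ.* + M) * T M L ≡ C L M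
    bT′≡C = trans bT′≡C′ (C-comm M L)

  invariant-zero : ∀ M → Invariant M 0 → Invariant 0 M
  invariant-zero M (S≡C , _) = S0M≡C , trans (ℚP.*-identityˡ (T 0 M)) (trans (T-zero M) S0M≡C)
    where
    S0M≡C : S 0 M ≡ C 0 M
    S0M≡C = trans (S-comm 0 M) (trans S≡C (C-comm M 0))

  invariant : ∀ n L M → L ℕ.+ M ≡ n → Invariant L M
  invariant zero    zero    zero    _  = refl , refl
  invariant (suc n) (suc L) M       refl = invariant-suc L M (invariant n L M refl) (invariant n M L (ℕP.+-comm M L))
  invariant (suc n) zero    (suc M) refl =
    invariant-zero (suc M) (invariant-suc M 0 (invariant n M 0 (ℕP.+-identityʳ M)) (invariant n 0 M refl))

  S≡C : ∀ L M → S L M ≡ C L M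
  S≡C L M with invariant (L ℕ.+ M) L M refl
  ... | S≡C , _ = S≡C

-- Powers of q² avoid 1

geometric : ℚ → ℕ → ℚ
geometric x zero    = 1ℚ
geometric x (suc n) = geometric x n + x ^ℚ suc n

1-x^[1+n]≡[1-x]*geometric : ∀ x n → 1ℚ - x ^ℚ suc n ≡ (1ℚ - x) * geometric x n
1-x^[1+n]≡[1-x]*geometric x zero    = base x
  where
  base : ∀ x → 1ℚ - x * 1ℚ ≡ (1ℚ - x) * 1ℚ
  base = solve-∀ ℚ-ring
1-x^[1+n]≡[1-x]*geometric x (suc n) = begin
  1ℚ - x * x ^ℚ suc n                               ≡⟨ split x (x ^ℚ n) ⟩
  (1ℚ - x ^ℚ suc n) + (1ℚ - x) * x ^ℚ suc n         ≡⟨ cong (_+ (1ℚ - x) * x ^ℚ suc n) (1-x^[1+n]≡[1-x]*geometric x n) ⟩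
  (1ℚ - x) * geometric x n + (1ℚ - x) * x ^ℚ suc n  ≡⟨ sym (ℚP.*-distribˡ-+ (1ℚ - x) (geometric x n) _) ⟩
  (1ℚ - x) * geometric x (suc n)                    ∎
  where
  split : ∀ x y → 1ℚ - x * (x * y) ≡ (1ℚ - x * y) + (1ℚ - x) * (x * y)
  split = solve-∀ ℚ-ring

0≤x^n : ∀ x n → 0ℚ ≤ x → 0ℚ ≤ x ^ℚ n
0≤x^n x zero    0≤x = ℚP.nonNegative⁻¹ 1ℚ
0≤x^n x (suc n) 0≤x = ℚP.nonNegative⁻¹ (x * x ^ℚ n)
  {{ℚP.nonNeg*nonNeg⇒nonNeg x {{ℚ.nonNegative 0≤x}} (x ^ℚ n) {{ℚ.nonNegative (0≤x^n x n 0≤x)}}}}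

0≤x^2 : ∀ x → 0ℚ ≤ x ^ℚ 2
0≤x^2 x with ℚP.≤-total 0ℚ x
... | inj₁ 0≤x = 0≤x^n x 2 0≤x
... | inj₂ x≤0 = ℚP.nonNegative⁻¹ (x * (x * 1ℚ))
  {{ℚP.nonPos*nonPos⇒nonPos x {{ℚ.nonPositive x≤0}} (x * 1ℚ) {{ℚ.nonPositive (subst (_≤ 0ℚ) (sym (ℚP.*-identityʳ x)) x≤0)}}}}

1≤geometric : ∀ x n → 0ℚ ≤ x → 1ℚ ≤ geometric x n
1≤geometric x zero    0≤x = ℚP.≤-refl
1≤geometric x (suc n) 0≤x = ℚP.≤-trans (1≤geometric x n 0≤x)
  (subst (_≤ geometric x (suc n)) (ℚP.+-identityʳ (geometric x n)) (ℚP.+-monoʳ-≤ (geometric x n) (0≤x^n x (suc n) 0≤x)))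

1≰0 : ¬ (1ℚ ≤ 0ℚ)
1≰0 (ℚ.*≤* (ℤ.+≤+ ()))

q²^suc≢1 : ∀ {q} → q ≢ 1ℚ → q ≢ - 1ℚ → ∀ j → (q ^ℚ 2) ^ℚ suc j ≢ 1ℚ
q²^suc≢1 {q} q≢1 q≢-1 j p^[1+j]≡1 =
  q≢-1 (x+1≡0⇒x≡-1 (*≡0⇒≡0 q-1≢0 (trans (difference-of-squares q) (cong (_- 1ℚ) q²≡1))))
  where
  p = q ^ℚ 2
  geometric≢0 : geometric p j ≢ 0ℚ
  geometric≢0 g≡0 = 1≰0 (subst (1ℚ ≤_) g≡0 (1≤geometric p j (0≤x^2 q)))
  q²≡1 : p ≡ 1ℚ
  q²≡1 = 1-x≡0⇒x≡1 (*≡0⇒≡0 geometric≢0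
    (trans (ℚP.*-comm (geometric p j) (1ℚ - p)) (trans (sym (1-x^[1+n]≡[1-x]*geometric p j)) (cong (λ z → 1ℚ - z) p^[1+j]≡1))))
  q-1≢0 : q - 1ℚ ≢ 0ℚ
  q-1≢0 q-1≡0 = q≢1 (trans (add-back q) (cong (_+ 1ℚ) q-1≡0))
    where
    add-back : ∀ x → x ≡ (x - 1ℚ) + 1ℚ
    add-back = solve-∀ ℚ-ring
  x+1≡0⇒x≡-1 : ∀ {x} → x + 1ℚ ≡ 0ℚ → x ≡ - 1ℚ
  x+1≡0⇒x≡-1 {x} x+1≡0 = trans (subtract-back x) (cong (_- 1ℚ) x+1≡0)
    where
    subtract-back : ∀ x → x ≡ (x + 1ℚ) - 1ℚ
    subtract-back = solve-∀ ℚ-ring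
  difference-of-squares : ∀ x → (x - 1ℚ) * (x + 1ℚ) ≡ x * (x * 1ℚ) - 1ℚ
  difference-of-squares = solve-∀ ℚ-ring

-- The case q = 0

δ : ℤ → ℚ
δ (+ zero)  = 1ℚ
δ (+ suc _) = 0ℚ
δ -[1+ _ ]  = 0ℚ

δ-miss : ∀ {x} → x ≢ + 0 → δ x ≡ 0ℚ
δ-miss {+ zero}    x≢0 = ⊥-elim (x≢0 refl)
δ-miss {+ suc _}   _   = refl
δ-miss { -[1+ _ ]} _   = refl

-m+k≡0⇒k≡m : ∀ m k → ℤ.- (+ m) ℤ.+ + k ≡ + 0 → k ≡ m
-m+k≡0⇒k≡m m k e = ℤP.+-injective (trans (add-back (+ m) (+ k)) (trans (cong (ℤ._+ + m) e) (ℤP.+-identityˡ (+ m))))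
  where
  add-back : ∀ x y → y ≡ ℤ.- x ℤ.+ y ℤ.+ x
  add-back = ℤ-Solver.solve-∀

sumFrom-δ-miss : ∀ m n → n ℕ.≤ m → sumFrom (ℤ.- (+ m)) n δ ≡ 0ℚ
sumFrom-δ-miss m zero    _   = refl
sumFrom-δ-miss m (suc n) n<m =
  cong₂ _+_ (sumFrom-δ-miss m n (ℕP.<⇒≤ n<m)) (δ-miss (λ e → ℕP.<⇒≢ n<m (-m+k≡0⇒k≡m m n e)))

sumFrom-δ-hit : ∀ m n → m ℕ.< n → sumFrom (ℤ.- (+ m)) n δ ≡ 1ℚ
sumFrom-δ-hit m (suc n) m<1+n with m ℕP.≟ n
... | yes refl = cong₂ _+_ (sumFrom-δ-miss m m ℕP.≤-refl) (cong δ (ℤP.+-inverseˡ (+ m)))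
... | no  m≢n  = cong₂ _+_ (sumFrom-δ-hit m n (ℕP.≤∧≢⇒< (ℕP.≤-pred m<1+n) m≢n))
                           (δ-miss (λ e → m≢n (sym (-m+k≡0⇒k≡m m n e))))

sumFrom-δ-positive : ∀ m n → sumFrom (+ suc m) n δ ≡ 0ℚ
sumFrom-δ-positive m zero    = refl
sumFrom-δ-positive m (suc n) = cong (_+ 0ℚ) (sumFrom-δ-positive m n)

sumFrom-cong-range : ∀ a n {f g : ℤ → ℚ} → (∀ k → k ℕ.< n → f (a ℤ.+ + k) ≡ g (a ℤ.+ + k)) →
  sumFrom a n f ≡ sumFrom a n g
sumFrom-cong-range a zero    _   = refl
sumFrom-cong-range a (suc n) f≗g =
  cong₂ _+_ (sumFrom-cong-range a n (λ k k<n → f≗g k (ℕP.m<n⇒m<1+n k<n))) (f≗g n ℕP.≤-refl)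

sumFrom-telescope : ∀ (h : ℤ → ℚ) a n → sumFrom a n (λ j → h j - h (j ℤ.- + 1)) ≡ h (a ℤ.+ + n ℤ.- + 1) - h (a ℤ.- + 1)
sumFrom-telescope h a zero    =
  trans (sym (ℚP.+-inverseʳ (h (a ℤ.- + 1)))) (cong (λ z → h (z ℤ.- + 1) - h (a ℤ.- + 1)) (sym (ℤP.+-identityʳ a)))
sumFrom-telescope h a (suc n) = begin
  sumFrom a n (λ j → h j - h (j ℤ.- + 1)) + (h (a ℤ.+ + n) - h (a ℤ.+ + n ℤ.- + 1))
    ≡⟨ cong (_+ (h (a ℤ.+ + n) - h (a ℤ.+ + n ℤ.- + 1))) (sumFrom-telescope h a n) ⟩
  (h (a ℤ.+ + n ℤ.- + 1) - h (a ℤ.- + 1)) + (h (a ℤ.+ + n) - h (a ℤ.+ + n ℤ.- + 1))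
    ≡⟨ cancel (h (a ℤ.+ + n ℤ.- + 1)) (h (a ℤ.- + 1)) (h (a ℤ.+ + n)) ⟩
  h (a ℤ.+ + n) - h (a ℤ.- + 1)
    ≡⟨ cong (λ z → h z - h (a ℤ.- + 1)) (reindex a (+ n)) ⟩
  h (a ℤ.+ + suc n ℤ.- + 1) - h (a ℤ.- + 1) ∎
  where
  cancel : ∀ x y z → (x - y) + (z - x) ≡ z - y
  cancel = solve-∀ ℚ-ring
  reindex : ∀ a n → a ℤ.+ n ≡ a ℤ.+ (+ 1 ℤ.+ n) ℤ.- + 1
  reindex = ℤ-Solver.solve-∀

0^n≡0 : ∀ n → n ≢ 0 → 0ℚ ^ℚ n ≡ 0ℚ
0^n≡0 zero    n≢0 = ⊥-elim (n≢0 refl)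
0^n≡0 (suc n) _   = ℚP.*-zeroˡ (0ℚ ^ℚ n)

qPoch-0 : ∀ p n → qPoch 0ℚ p n ≡ 1ℚ
qPoch-0 p zero    = refl
qPoch-0 p (suc n) rewrite qPoch-0 p n | ℚP.*-zeroˡ (p ^ℚ n) = refl

negOnePow-even : ∀ n → negOnePow (+ (n ℕ.+ n)) ≡ 1ℚ
negOnePow-even zero    = refl
negOnePow-even (suc n) = begin
  - 1ℚ * (- 1ℚ) ^ℚ (n ℕ.+ suc n)        ≡⟨ cong (λ k → - 1ℚ * (- 1ℚ) ^ℚ k) (ℕP.+-suc n n) ⟩
  - 1ℚ * (- 1ℚ * (- 1ℚ) ^ℚ (n ℕ.+ n))   ≡⟨ sign-squared ((- 1ℚ) ^ℚ (n ℕ.+ n)) ⟩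
  (- 1ℚ) ^ℚ (n ℕ.+ n)                   ≡⟨ negOnePow-even n ⟩
  1ℚ                                    ∎
  where
  sign-squared : ∀ x → - 1ℚ * (- 1ℚ * x) ≡ x
  sign-squared = solve-∀ ℚ-ring

module AtZero where

  open GaussianBinomial (0ℚ ^ℚ 2)
  open NotRootOfUnity (q²^suc≢1 {0ℚ} (λ ()) (λ ()))

  qBinom-at-0 : ∀ n m → qBinom n m ≡ 1ℚ
  qBinom-at-0 zero    m       = refl
  qBinom-at-0 (suc n) zero    = refl
  qBinom-at-0 (suc n) (suc m)
    rewrite qBinom-at-0 n (suc m) | qBinom-at-0 (suc n) m | ℚP.*-zeroˡ ((0ℚ ^ℚ 2) ^ℚ n) = refl

  central-at-0 : ∀ L k → k ℕ.< suc (2 ℕ.* L) → central L (ℤ.- (+ L) ℤ.+ + k) ≡ 1ℚ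
  central-at-0 L k k<1+2L with placement k (2 ℕ.* L)
  ... | within m k+m≡2L = begin
    gauss (0ℚ ^ℚ 2) (+ (2 ℕ.* L)) (+ L ℤ.- (ℤ.- (+ L) ℤ.+ + k))
      ≡⟨ cong (gauss (0ℚ ^ℚ 2) (+ (2 ℕ.* L))) index ⟩
    gauss (0ℚ ^ℚ 2) (+ (2 ℕ.* L)) (+ m)
      ≡⟨ gauss-inside m k (trans (ℕP.+-comm m k) k+m≡2L) ⟩
    qBinom m k
      ≡⟨ qBinom-at-0 m k ⟩
    1ℚ ∎
    where
    reflect : ∀ x k → x ℤ.- (ℤ.- x ℤ.+ k) ≡ + 2 ℤ.* x ℤ.- k
    reflect = ℤ-Solver.solve-∀
    index : + L ℤ.- (ℤ.- (+ L) ℤ.+ + k) ≡ + m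
    index = begin
      + L ℤ.- (ℤ.- (+ L) ℤ.+ + k)  ≡⟨ reflect (+ L) (+ k) ⟩
      + 2 ℤ.* + L ℤ.- + k          ≡⟨ cong (ℤ._- + k) (sym (ℤP.pos-* 2 L)) ⟩
      + (2 ℕ.* L) ℤ.- + k          ≡⟨ cong (λ n → + n ℤ.- + k) (sym k+m≡2L) ⟩
      + (k ℕ.+ m) ℤ.- + k          ≡⟨ +[k+m]-+k≡+m k m ⟩
      + m                          ∎
  ... | beyond b 2L+1+b≡k =
    ⊥-elim (ℕP.<⇒≱ (subst (2 ℕ.* L ℕ.<_) 2L+1+b≡k (ℕP.m<m+n (2 ℕ.* L) (ℕ.s≤s ℕ.z≤n))) (ℕP.≤-pred k<1+2L))

  θ₀ : ℤ → ℚ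
  θ₀ k = negOnePow k * 0ℚ ^ℚ binom2 k

  θ₀-vanishes : ∀ k n → binom2 k ≡ suc n → θ₀ k ≡ 0ℚ
  θ₀-vanishes k n binom2≡1+n = begin
    negOnePow k * 0ℚ ^ℚ binom2 k         ≡⟨ cong (λ b → negOnePow k * 0ℚ ^ℚ b) binom2≡1+n ⟩
    negOnePow k * (0ℚ * 0ℚ ^ℚ n)         ≡⟨ cong (negOnePow k *_) (ℚP.*-zeroˡ (0ℚ ^ℚ n)) ⟩
    negOnePow k * 0ℚ                     ≡⟨ ℚP.*-zeroʳ (negOnePow k) ⟩
    0ℚ                                   ∎

  θ₀≡δ-δ : ∀ k → θ₀ k ≡ δ k - δ (k ℤ.- + 1)
  θ₀≡δ-δ (+ zero)        = refl
  θ₀≡δ-δ (+ suc zero)    = refl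
  θ₀≡δ-δ (+ suc (suc n)) = θ₀-vanishes (+ suc (suc n)) (n ℕ.+ triangle n) (binom2-+suc (suc n))
  θ₀≡δ-δ -[1+ n ]        = θ₀-vanishes -[1+ n ] (n ℕ.+ triangle n) (binom2--suc n)

  rhs : ℕ → ℕ → ℚ
  rhs L M = negOnePow (+ (M ℕ.+ L)) * (0ℚ ^ℚ (∣ + L ℤ.- + M ∣ ℕ.^ 2)) * qPoch 0ℚ (0ℚ ^ℚ 2) (L ℕ.+ M)

  rhs-off-diagonal : ∀ L M n → ∣ + L ℤ.- + M ∣ ≡ suc n → rhs L M ≡ 0ℚ
  rhs-off-diagonal L M n ∣L-M∣≡1+n = begin
    negOnePow (+ (M ℕ.+ L)) * (0ℚ ^ℚ (∣ + L ℤ.- + M ∣ ℕ.^ 2)) * qPoch 0ℚ (0ℚ ^ℚ 2) (L ℕ.+ M)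
      ≡⟨ cong (λ e → negOnePow (+ (M ℕ.+ L)) * (0ℚ ^ℚ (e ℕ.^ 2)) * qPoch 0ℚ (0ℚ ^ℚ 2) (L ℕ.+ M)) ∣L-M∣≡1+n ⟩
    negOnePow (+ (M ℕ.+ L)) * (0ℚ ^ℚ (suc n ℕ.^ 2)) * qPoch 0ℚ (0ℚ ^ℚ 2) (L ℕ.+ M)
      ≡⟨ cong (λ x → negOnePow (+ (M ℕ.+ L)) * x * qPoch 0ℚ (0ℚ ^ℚ 2) (L ℕ.+ M)) (0^[1+n]^2≡0 n) ⟩
    negOnePow (+ (M ℕ.+ L)) * 0ℚ * qPoch 0ℚ (0ℚ ^ℚ 2) (L ℕ.+ M)
      ≡⟨ annihilate (negOnePow (+ (M ℕ.+ L))) (qPoch 0ℚ (0ℚ ^ℚ 2) (L ℕ.+ M)) ⟩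
    0ℚ ∎
    where
    0^[1+n]^2≡0 : ∀ n → 0ℚ ^ℚ (suc n ℕ.^ 2) ≡ 0ℚ
    0^[1+n]^2≡0 n = 0^n≡0 (suc n ℕ.^ 2) (λ ())
    annihilate : ∀ a b → a * 0ℚ * b ≡ 0ℚ
    annihilate = solve-∀ ℚ-ring

  rhs-diagonal : ∀ M → rhs (M ℕ.+ 0) M ≡ 1ℚ
  rhs-diagonal M = begin
    negOnePow (+ (M ℕ.+ (M ℕ.+ 0))) * (0ℚ ^ℚ (∣ + (M ℕ.+ 0) ℤ.- + M ∣ ℕ.^ 2)) * qPoch 0ℚ (0ℚ ^ℚ 2) (M ℕ.+ 0 ℕ.+ M)
      ≡⟨ cong₂ (λ n e → negOnePow (+ (M ℕ.+ n)) * (0ℚ ^ℚ (∣ e ∣ ℕ.^ 2)) * qPoch 0ℚ (0ℚ ^ℚ 2) (M ℕ.+ 0 ℕ.+ M))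
               (ℕP.+-identityʳ M) (+[k+m]-+k≡+m M 0) ⟩
    negOnePow (+ (M ℕ.+ M)) * 1ℚ * qPoch 0ℚ (0ℚ ^ℚ 2) (M ℕ.+ 0 ℕ.+ M)
      ≡⟨ cong₂ (λ x y → x * 1ℚ * y) (negOnePow-even M) (qPoch-0 (0ℚ ^ℚ 2) (M ℕ.+ 0 ℕ.+ M)) ⟩
    1ℚ ∎

  lower-start : ∀ L M → ℤ.- (+ L) ℤ.+ (ℤ.- (+ M) ℤ.- + 1) ≡ ℤ.- (+ (L ℕ.+ M ℕ.+ 1))
  lower-start L M =
    trans (negate-sum (+ L) (+ M)) (cong ℤ.-_ (sym (trans (ℤP.pos-+ (L ℕ.+ M) 1) (cong (ℤ._+ + 1) (ℤP.pos-+ L M)))))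
    where
    negate-sum : ∀ x y → ℤ.- x ℤ.+ (ℤ.- y ℤ.- + 1) ≡ ℤ.- (x ℤ.+ y ℤ.+ + 1)
    negate-sum = ℤ-Solver.solve-∀

  upper-start-within : ∀ M d → ℤ.- (+ (M ℕ.+ d)) ℤ.+ + M ≡ ℤ.- (+ d)
  upper-start-within M d = trans (cong (λ z → ℤ.- z ℤ.+ + M) (ℤP.pos-+ M d)) (cancel (+ M) (+ d))
    where
    cancel : ∀ x y → ℤ.- (x ℤ.+ y) ℤ.+ x ≡ ℤ.- y
    cancel = ℤ-Solver.solve-∀

  upper-start-beyond : ∀ L b → ℤ.- (+ L) ℤ.+ + (L ℕ.+ suc b) ≡ + suc b
  upper-start-beyond L b = trans (cong (λ z → ℤ.- (+ L) ℤ.+ z) (ℤP.pos-+ L (suc b))) (cancel (+ L) (+ suc b))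
    where
    cancel : ∀ x y → ℤ.- x ℤ.+ (x ℤ.+ y) ≡ y
    cancel = ℤ-Solver.solve-∀

  -- The two sums count whether -M resp. M + 1 lies in [-L, L]; they differ exactly when L = M.
  indicator-difference : ∀ L M →
    sumFrom (ℤ.- (+ L) ℤ.+ + M) (suc (2 ℕ.* L)) δ - sumFrom (ℤ.- (+ L) ℤ.+ (ℤ.- (+ M) ℤ.- + 1)) (suc (2 ℕ.* L)) δ
    ≡ rhs L M
  indicator-difference L M with placement M L
  indicator-difference .(M ℕ.+ 0) M | within zero refl = begin
    sumFrom (ℤ.- (+ (M ℕ.+ 0)) ℤ.+ + M) n δ - sumFrom (ℤ.- (+ (M ℕ.+ 0)) ℤ.+ (ℤ.- (+ M) ℤ.- + 1)) n δ
      ≡⟨ cong₂ _-_ (trans (cong (λ a → sumFrom a n δ) (upper-start-within M 0)) (sumFrom-δ-hit 0 n (ℕ.s≤s ℕ.z≤n)))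
                   (trans (cong (λ a → sumFrom a n δ) (lower-start (M ℕ.+ 0) M))
                          (sumFrom-δ-miss (M ℕ.+ 0 ℕ.+ M ℕ.+ 1) n (ℕP.≤-reflexive (count M)))) ⟩
    1ℚ - 0ℚ
      ≡⟨ sym (rhs-diagonal M) ⟩
    rhs (M ℕ.+ 0) M ∎
    where
    n = suc (2 ℕ.* (M ℕ.+ 0))
    count : ∀ M → suc (2 ℕ.* (M ℕ.+ 0)) ≡ M ℕ.+ 0 ℕ.+ M ℕ.+ 1
    count = ℕ-Solver.solve-∀
  indicator-difference .(M ℕ.+ suc d) M | within (suc d) refl = begin
    sumFrom (ℤ.- (+ L) ℤ.+ + M) n δ - sumFrom (ℤ.- (+ L) ℤ.+ (ℤ.- (+ M) ℤ.- + 1)) n δ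
      ≡⟨ cong₂ _-_ (trans (cong (λ a → sumFrom a n δ) (upper-start-within M (suc d)))
                          (sumFrom-δ-hit (suc d) n (ℕ.s≤s (ℕP.≤-trans (ℕP.m≤n+m (suc d) M) (ℕP.m≤m+n L (L ℕ.+ 0))))))
                   (trans (cong (λ a → sumFrom a n δ) (lower-start L M))
                          (sumFrom-δ-hit (L ℕ.+ M ℕ.+ 1) n (subst (L ℕ.+ M ℕ.+ 1 ℕ.<_) (count M d) (ℕP.m<m+n _ (ℕ.s≤s ℕ.z≤n))))) ⟩
    1ℚ - 1ℚ
      ≡⟨ sym (rhs-off-diagonal L M d (cong ∣_∣ (+[k+m]-+k≡+m M (suc d)))) ⟩
    rhs L M ∎
    where
    L = M ℕ.+ suc d
    n = suc (2 ℕ.* L)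
    count : ∀ M d → M ℕ.+ suc d ℕ.+ M ℕ.+ 1 ℕ.+ suc d ≡ suc (2 ℕ.* (M ℕ.+ suc d))
    count = ℕ-Solver.solve-∀
  indicator-difference L .(L ℕ.+ suc b) | beyond b refl = begin
    sumFrom (ℤ.- (+ L) ℤ.+ + M) n δ - sumFrom (ℤ.- (+ L) ℤ.+ (ℤ.- (+ M) ℤ.- + 1)) n δ
      ≡⟨ cong₂ _-_ (trans (cong (λ a → sumFrom a n δ) (upper-start-beyond L b)) (sumFrom-δ-positive b n))
                   (trans (cong (λ a → sumFrom a n δ) (lower-start L M))
                          (sumFrom-δ-miss (L ℕ.+ M ℕ.+ 1) n (subst (n ℕ.≤_) (count L b) (ℕP.m≤m+n n (suc b))))) ⟩
    0ℚ - 0ℚ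
      ≡⟨ sym (rhs-off-diagonal L M b (cong ∣_∣ (+n-+[n+suc-b]≡-[1+b] L b))) ⟩
    rhs L M ∎
    where
    M = L ℕ.+ suc b
    n = suc (2 ℕ.* L)
    count : ∀ L b → suc (2 ℕ.* L) ℕ.+ suc b ≡ L ℕ.+ (L ℕ.+ suc b) ℕ.+ 1
    count = ℕ-Solver.solve-∀

  row-telescopes : ∀ M i → sumSym M (λ j → θ₀ (i ℤ.+ j)) ≡ δ (i ℤ.+ + M) - δ (i ℤ.+ (ℤ.- (+ M) ℤ.- + 1))
  row-telescopes M i = begin
    sumSym M (λ j → θ₀ (i ℤ.+ j))
      ≡⟨ sumSym-cong M (λ j → trans (θ₀≡δ-δ (i ℤ.+ j)) (cong (λ z → δ (i ℤ.+ j) - δ z) (reassociate i j))) ⟩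
    sumFrom (ℤ.- (+ M)) (suc (2 ℕ.* M)) (λ j → h j - h (j ℤ.- + 1))
      ≡⟨ sumFrom-telescope h (ℤ.- (+ M)) (suc (2 ℕ.* M)) ⟩
    h (ℤ.- (+ M) ℤ.+ + suc (2 ℕ.* M) ℤ.- + 1) - h (ℤ.- (+ M) ℤ.- + 1)
      ≡⟨ cong (λ z → h z - h (ℤ.- (+ M) ℤ.- + 1)) top ⟩
    h (+ M) - h (ℤ.- (+ M) ℤ.- + 1) ∎
    where
    h : ℤ → ℚ
    h j = δ (i ℤ.+ j)
    reassociate : ∀ i j → i ℤ.+ j ℤ.- + 1 ≡ i ℤ.+ (j ℤ.- + 1)
    reassociate = ℤ-Solver.solve-∀
    top : ℤ.- (+ M) ℤ.+ + suc (2 ℕ.* M) ℤ.- + 1 ≡ + M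
    top = cong (ℤ._- + 1) (-n+[d+2n]≡d+n M 1)

  sum-at-0 : ∀ L M → sumSym L (λ i → sumSym M (λ j → θ₀ (i ℤ.+ j) * central L i * central M j)) ≡ rhs L M
  sum-at-0 L M = begin
    sumSym L (λ i → sumSym M (λ j → θ₀ (i ℤ.+ j) * central L i * central M j))
      ≡⟨ sumFrom-cong-range (ℤ.- (+ L)) (suc (2 ℕ.* L)) (λ k k<n → sumFrom-cong-range (ℤ.- (+ M)) (suc (2 ℕ.* M)) (λ k′ k′<n →
           let i = ℤ.- (+ L) ℤ.+ + k ; j = ℤ.- (+ M) ℤ.+ + k′ in
           trans (cong₂ (λ x y → θ₀ (i ℤ.+ j) * x * y) (central-at-0 L k k<n) (central-at-0 M k′ k′<n))
                 (trans (ℚP.*-identityʳ (θ₀ (i ℤ.+ j) * 1ℚ)) (ℚP.*-identityʳ (θ₀ (i ℤ.+ j)))))) ⟩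
    sumSym L (λ i → sumSym M (λ j → θ₀ (i ℤ.+ j)))
      ≡⟨ sumSym-cong L (row-telescopes M) ⟩
    sumSym L (λ i → δ (i ℤ.+ + M) - δ (i ℤ.+ c))
      ≡⟨ trans (sumSym-+ L (λ i → δ (i ℤ.+ + M)) (λ i → - δ (i ℤ.+ c)))
               (cong (λ x → sumSym L (λ i → δ (i ℤ.+ + M)) + x) (sumSym-neg L (λ i → δ (i ℤ.+ c)))) ⟩
    sumSym L (λ i → δ (i ℤ.+ + M)) - sumSym L (λ i → δ (i ℤ.+ c))
      ≡⟨ cong₂ _-_ (sumFrom-shift (ℤ.- (+ L)) (suc (2 ℕ.* L)) (+ M) δ) (sumFrom-shift (ℤ.- (+ L)) (suc (2 ℕ.* L)) c δ) ⟩
    sumFrom (ℤ.- (+ L) ℤ.+ + M) (suc (2 ℕ.* L)) δ - sumFrom (ℤ.- (+ L) ℤ.+ c) (suc (2 ℕ.* L)) δ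
      ≡⟨ indicator-difference L M ⟩
    rhs L M ∎
    where
    c = ℤ.- (+ M) ℤ.- + 1

mainTheorem6 : (q : ℚ) → q ≢ 1ℚ → q ≢ - 1ℚ → (L M : ℕ) →
    sumSym L (λ i → sumSym M (λ j →
        negOnePow (i ℤ.+ j) * (q ^ℚ binom2 (i ℤ.+ j))
        * gauss (q ^ℚ 2) (+ (2 ℕ.* L)) (+ L ℤ.- i)
        * gauss (q ^ℚ 2) (+ (2 ℕ.* M)) (+ M ℤ.- j)))
    ≡ negOnePow (+ (M ℕ.+ L)) * (q ^ℚ (∣ + L ℤ.- + M ∣ ℕ.^ 2))
      * qPoch q (q ^ℚ 2) (L ℕ.+ M)
mainTheorem6 q q≢1 q≢-1 L M with q ℚP.≟ 0ℚ
... | yes refl = AtZero.sum-at-0 L M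
... | no  q≢0  = Pairing.S≡C q q≢0 (q²^suc≢1 q≢1 q≢-1) L M
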